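{- If $m\ge 3$ is odd and $k\ge 1$, then $\textup{aw}(P_m\square C_{4k},3)=3$.
   Context: All graphs are finite, simple and undirected; $\textup{d}(u,v)$ denotes shortest-path distance. $P_m$ is the path on $m$ vertices and $C_n$ the cycle on $n$ vertices. The Cartesian product $G\square H$ has vertex set $V(G)\times V(H)$, with $(x,y)$ adjacent to $(x',y')$ iff either $x=x'$ and $yy'\in E(H)$, or $y=y'$ and $xx'\in E(G)$. A 3-term arithmetic progression (3-AP) is a set of vertices $\{v_1,v_2,v_3\}$ (listed in some order) with $\textup{d}(v_1,v_2)=\textup{d}(v_2,v_3)$. An exact $r$-coloring of a graph $G$ is a surjective map $c:V(G)\to\{1,\dots,r\}$; a set is rainbow under $c$ if its vertices receive pairwise distinct colors. $\textup{aw}(G,3)$ is the least positive integer $r$ such that every exact $r$-coloring of $G$ contains a rainbow 3-AP; if no coloring yields a rainbow 3-AP, then $\textup{aw}(G,3)=|V(G)|+1$. -}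

module Defs where

open import Data.Nat using (ℕ; zero; suc; _≤_; _<_; _*_)
open import Data.Fin using (Fin; toℕ)
open import Data.Product using (Σ; ∃; _×_; _,_)
open import Data.Sum using (_⊎_)
open import Relation.Nullary using (¬_)
open import Relation.Binary.PropositionalEquality using (_≡_; _≢_)

record Graph : Set₁ where
  field
    V   : Set
    Adj : V → V → Set
open Graph public

P : ℕ → Graph
P m = record { V = Fin m
             ; Adj = λ i j → suc (toℕ i) ≡ toℕ j ⊎ suc (toℕ j) ≡ toℕ i }

C : ℕ → Graph
C n = record { V = Fin n ; Adj = λ i j → Step i j ⊎ Step j i }
  where
  Step : Fin n → Fin n → Set
  Step i j = suc (toℕ i) ≡ toℕ j ⊎ (suc (toℕ i) ≡ n × toℕ j ≡ 0)

_□_ : Graph → Graph → Graph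
G □ H = record
  { V = V G × V H
  ; Adj = λ { (x , y) (x' , y') → (x ≡ x' × Adj H y y') ⊎ (y ≡ y' × Adj G x x') } }

data Walk (G : Graph) : V G → V G → ℕ → Set where
  here : ∀ {u} → Walk G u u 0
  step : ∀ {u w v ℓ} → Adj G u w → Walk G w v ℓ → Walk G u v (suc ℓ)

Dist : (G : Graph) → V G → V G → ℕ → Set
Dist G u v d = Walk G u v d × (∀ ℓ → Walk G u v ℓ → d ≤ ℓ)

ExactColoring : (G : Graph) → ℕ → Set
ExactColoring G r = Σ (V G → Fin r) λ c → ∀ i → ∃ λ v → c v ≡ i

HasRainbow3AP : (G : Graph) {r : ℕ} → (V G → Fin r) → Set
HasRainbow3AP G c =
  ∃ λ v₁ → ∃ λ v₂ → ∃ λ v₃ →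
    (c v₁ ≢ c v₂ × c v₂ ≢ c v₃ × c v₁ ≢ c v₃) ×
    ∃ λ d → Dist G v₁ v₂ d × Dist G v₂ v₃ d

AllRainbow : Graph → ℕ → Set
AllRainbow G r = (c : ExactColoring G r) → HasRainbow3AP G (Σ.proj₁ c)

-- aw(G,3) = r : r is the least positive integer with AllRainbow G r.
-- (For r > |V(G)| there are no exact r-colorings, so AllRainbow holds
-- vacuously; hence the fallback value |V(G)|+1 is covered automatically.)
AW3 : Graph → ℕ → Set
AW3 G r = 1 ≤ r × AllRainbow G r × (∀ r' → 1 ≤ r' → r' < r → ¬ AllRainbow G r')

-- Distances in P m □ C n are |Δrow| + (cyclic distance of the columns). Given an exact 3-colouring,
-- take an edge pq with c p ≠ c q and a vertex w of the third colour. If d(w,p) = d(w,q) we are done;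
-- otherwise a geodesic from w through the edge meets all three colours, and a shortest stretch of it
-- doing so has ends x, z of different colours and an interior of the third colour Y. If its length
-- is even its midpoint gives a rainbow 3-AP. If it is odd, every sphere of radius 1 … L-1 around x
-- and around z meets Y, which forces the colours of many vertices: normalising x = (i,0) and
-- z = (i+Δ,e) with e ≤ n/2 by an isometry, the vertex (i+1,-1) must have colour X, so x can be moved
-- one row towards z and one column away from it. This ends when x and z share a row (use an adjacent
-- row) or are antipodal in the cycle coordinate (use the row before x or after z), unless x and z are
-- opposite corners; then L = (m-1) + n/2 = 2j + 2k would be both odd and even.

module Submission where

open import Defs
open import Data.Nat
open import Data.Nat.Properties
open import Data.Nat.Tactic.RingSolver using (solve-∀)
open import Data.Fin using (Fin; toℕ; fromℕ<; opposite) renaming (_≟_ to _≟ᶠ_)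
open import Data.Fin.Properties
  using (toℕ-injective; toℕ-fromℕ<; fromℕ<-toℕ; toℕ<n; opposite-prop; opposite-involutive; all?; any?; ¬Fin0)
open import Data.Product using (Σ; ∃; _×_; _,_; proj₁; proj₂)
open import Data.Sum using (_⊎_; inj₁; inj₂; map₂; [_,_]′)
open import Data.Empty using (⊥; ⊥-elim)
open import Function using (_∘_)
open import Relation.Nullary using (¬_; ¬?; yes; no)
open import Relation.Nullary.Decidable using (from-yes; _×-dec_; _→-dec_)
open import Relation.Binary.PropositionalEquality
open import Relation.Binary.Definitions using (tri<; tri≈; tri>)

-- Walks and shortest-path distance

module _ {G : Graph} where

  _++ʷ_ : ∀ {u v w a b} → Walk G u v a → Walk G v w b → Walk G u w (a + b)
  here     ++ʷ q = q
  step e p ++ʷ q = step e (p ++ʷ q)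

  snocʷ : ∀ {u v w ℓ} → Walk G u v ℓ → Adj G v w → Walk G u w (suc ℓ)
  snocʷ here       e = step e here
  snocʷ (step e p) f = step e (snocʷ p f)

  castʷ : ∀ {u v a b} → a ≡ b → Walk G u v a → Walk G u v b
  castʷ refl p = p

  reverseʷ : (∀ {a b} → Adj G a b → Adj G b a) → ∀ {u v ℓ} → Walk G u v ℓ → Walk G v u ℓ
  reverseʷ sym here       = here
  reverseʷ sym (step e p) = snocʷ (reverseʷ sym p) (sym e)

  -- The vertex reached after t steps; it stays at the endpoint once t ≥ ℓ.
  _at_ : ∀ {u v ℓ} → Walk G u v ℓ → ℕ → V G
  _at_ {u} here       t       = u
  _at_ {u} (step e p) zero    = u
  step e p at suc t           = p at t

  at-zero : ∀ {u v ℓ} (p : Walk G u v ℓ) → p at 0 ≡ u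
  at-zero here       = refl
  at-zero (step e p) = refl

  at-end : ∀ {u v ℓ} (p : Walk G u v ℓ) → p at ℓ ≡ v
  at-end here       = refl
  at-end (step e p) = at-end p

  at-snoc : ∀ {u v w ℓ} (p : Walk G u v ℓ) (e : Adj G v w) t → t ≤ ℓ → snocʷ p e at t ≡ p at t
  at-snoc here       e zero    _         = refl
  at-snoc (step f p) e zero    _         = refl
  at-snoc (step f p) e (suc t) (s≤s t≤ℓ) = at-snoc p e t t≤ℓ

  takeʷ : ∀ {u v ℓ} (p : Walk G u v ℓ) t → t ≤ ℓ → Walk G u (p at t) t
  takeʷ here       zero    _         = here
  takeʷ (step e p) zero    _         = here
  takeʷ (step e p) (suc t) (s≤s t≤ℓ) = step e (takeʷ p t t≤ℓ)

  dropʷ : ∀ {u v ℓ} (p : Walk G u v ℓ) t → t ≤ ℓ → Walk G (p at t) v (ℓ ∸ t)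
  dropʷ here       zero    _         = here
  dropʷ (step e p) zero    _         = step e p
  dropʷ (step e p) (suc t) (s≤s t≤ℓ) = dropʷ p t t≤ℓ

  sliceʷ : ∀ {u v ℓ} (p : Walk G u v ℓ) i j → i ≤ j → j ≤ ℓ → Walk G (p at i) (p at j) (j ∸ i)
  sliceʷ here       zero    j       _         j≤ℓ       = takeʷ here j j≤ℓ
  sliceʷ (step e p) zero    j       _         j≤ℓ       = takeʷ (step e p) j j≤ℓ
  sliceʷ (step e p) (suc i) (suc j) (s≤s i≤j) (s≤s j≤ℓ) = sliceʷ p i j i≤j j≤ℓ
  sliceʷ here       (suc i) (suc j) _         ()

-- A distance function certified by geodesics and by being 1-Lipschitz along edges;
-- δ≤length below shows it is the shortest-path distance.
record Metric (G : Graph) : Set where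
  field
    δ        : V G → V G → ℕ
    geodesic : ∀ u v → Walk G u v (δ u v)
    δ-refl   : ∀ u → δ u u ≡ 0
    δ-step   : ∀ {u w} v → Adj G u w → δ u v ≤ suc (δ w v)

module MetricProperties {G : Graph} (M : Metric G) (adj-sym : ∀ {a b} → Adj G a b → Adj G b a) where
  open Metric M public

  δ≤length : ∀ {u v ℓ} → Walk G u v ℓ → δ u v ≤ ℓ
  δ≤length {u} here         = ≤-reflexive (δ-refl u)
  δ≤length {v = v} (step e p) = ≤-trans (δ-step v e) (s≤s (δ≤length p))

  δ-dist : ∀ {u v d} → d ≡ δ u v → Dist G u v d
  δ-dist {u} {v} refl = geodesic u v , λ _ → δ≤length

  δ-triangle : ∀ u v w → δ u w ≤ δ u v + δ v w
  δ-triangle u v w = δ≤length (geodesic u v ++ʷ geodesic v w)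

  δ-sym : ∀ u v → δ u v ≡ δ v u
  δ-sym u v = ≤-antisym (δ≤length (reverseʷ adj-sym (geodesic v u)))
                        (δ≤length (reverseʷ adj-sym (geodesic u v)))

  δ-adj : ∀ {u w} → Adj G u w → δ u w ≤ 1
  δ-adj e = δ≤length (step e here)

  δ-neighbour-≤ : ∀ w {a b} → Adj G a b → δ w b ≤ suc (δ w a)
  δ-neighbour-≤ w {a} {b} ab = ≤-trans (δ-triangle w a b) (≤-trans (+-monoʳ-≤ (δ w a) (δ-adj ab)) (≤-reflexive (+-comm (δ w a) 1)))

  δ-along-geodesic : ∀ {u v ℓ} (p : Walk G u v ℓ) → δ u v ≡ ℓ →
                     ∀ i j → i ≤ j → j ≤ ℓ → δ (p at i) (p at j) ≡ j ∸ i
  δ-along-geodesic {u} {v} {ℓ} p δ≡ℓ i j i≤j j≤ℓ = ≤-antisym (δ≤length (sliceʷ p i j i≤j j≤ℓ)) (m≤n+o⇒m∸n≤o j i j≤i+A)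
    where
    A = δ (p at i) (p at j)
    j≤i+A : j ≤ i + A
    j≤i+A = +-cancelʳ-≤ (ℓ ∸ j) j (i + A) (begin
      j + (ℓ ∸ j)                    ≡⟨ m+[n∸m]≡n j≤ℓ ⟩
      ℓ                              ≡⟨ δ≡ℓ ⟨
      δ u v                          ≤⟨ δ-triangle u (p at j) v ⟩
      δ u (p at j) + δ (p at j) v    ≤⟨ +-mono-≤ (δ-triangle u (p at i) (p at j)) (δ≤length (dropʷ p j j≤ℓ)) ⟩
      δ u (p at i) + A + (ℓ ∸ j)     ≤⟨ +-monoˡ-≤ (ℓ ∸ j) (+-monoˡ-≤ A (δ≤length (takeʷ p i (≤-trans i≤j j≤ℓ)))) ⟩
      i + A + (ℓ ∸ j)                ∎)
      where open ≤-Reasoning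

  δ-geodesic-start : ∀ u v {t} → t ≤ δ u v → δ u (geodesic u v at t) ≡ t
  δ-geodesic-start u v {t} t≤ =
    subst (λ a → δ a (geodesic u v at t) ≡ t) (at-zero (geodesic u v)) (δ-along-geodesic (geodesic u v) refl 0 t z≤n t≤)

  δ-geodesic-end : ∀ u v {t} → t ≤ δ u v → δ (geodesic u v at t) v ≡ δ u v ∸ t
  δ-geodesic-end u v {t} t≤ =
    subst (λ a → δ (geodesic u v at t) a ≡ δ u v ∸ t) (at-end (geodesic u v)) (δ-along-geodesic (geodesic u v) refl t _ t≤ ≤-refl)

  δ-through-neighbour : ∀ x w z {t} → δ x w ≡ 1 → δ x z ≡ suc (δ w z) → t ≤ δ w z → δ x (geodesic w z at t) ≡ suc t
  δ-through-neighbour x w z {t} δxw≡1 δxz≡ t≤ = ≤-antisym upper lower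
    where
    y = geodesic w z at t
    upper : δ x y ≤ suc t
    upper = ≤-trans (δ-triangle x w y) (≤-reflexive (cong₂ _+_ δxw≡1 (δ-geodesic-start w z t≤)))
    lower : suc t ≤ δ x y
    lower = +-cancelʳ-≤ (δ w z ∸ t) (suc t) (δ x y)
      (begin
        suc t + (δ w z ∸ t)  ≡⟨ cong suc (m+[n∸m]≡n t≤) ⟩
        suc (δ w z)          ≡⟨ δxz≡ ⟨
        δ x z                ≤⟨ δ-triangle x y z ⟩
        δ x y + δ y z        ≡⟨ cong (δ x y +_) (δ-geodesic-end w z t≤) ⟩
        δ x y + (δ w z ∸ t)  ∎)
      where open ≤-Reasoning

IsIsometry : ∀ {G} → Metric G → (V G → V G) → Set
IsIsometry M f = ∀ a b → Metric.δ M (f a) (f b) ≡ Metric.δ M a b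

-- The product, path and cycle metrics

module _ {G H : Graph} where

  □-sym : (∀ {a b} → Adj G a b → Adj G b a) → (∀ {a b} → Adj H a b → Adj H b a) →
          ∀ {a b} → Adj (G □ H) a b → Adj (G □ H) b a
  □-sym symG symH (inj₁ (refl , e)) = inj₁ (refl , symH e)
  □-sym symG symH (inj₂ (refl , e)) = inj₂ (refl , symG e)

  mapʷ₁ : ∀ {x x' ℓ} (y : V H) → Walk G x x' ℓ → Walk (G □ H) (x , y) (x' , y) ℓ
  mapʷ₁ y here       = here
  mapʷ₁ y (step e p) = step (inj₂ (refl , e)) (mapʷ₁ y p)

  mapʷ₂ : ∀ {y y' ℓ} (x : V G) → Walk H y y' ℓ → Walk (G □ H) (x , y) (x , y') ℓ
  mapʷ₂ x here       = here
  mapʷ₂ x (step e p) = step (inj₁ (refl , e)) (mapʷ₂ x p)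

  _□ᵐ_ : Metric G → Metric H → Metric (G □ H)
  MG □ᵐ MH = record
    { δ        = λ u v → δG (proj₁ u) (proj₁ v) + δH (proj₂ u) (proj₂ v)
    ; geodesic = λ { (x , y) (x' , y') → mapʷ₁ y (geodesic MG x x') ++ʷ mapʷ₂ x' (geodesic MH y y') }
    ; δ-refl   = λ { (x , y) → cong₂ _+_ (δ-refl MG x) (δ-refl MH y) }
    ; δ-step   = step-□
    }
    where
    open Metric
    δG = δ MG
    δH = δ MH
    step-□ : ∀ {u w} v → Adj (G □ H) u w →
             δG (proj₁ u) (proj₁ v) + δH (proj₂ u) (proj₂ v) ≤ suc (δG (proj₁ w) (proj₁ v) + δH (proj₂ w) (proj₂ v))
    step-□ {x , y} (x'' , y'') (inj₁ (refl , e)) =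
      ≤-trans (+-monoʳ-≤ (δG x x'') (δ-step MH y'' e)) (≤-reflexive (+-suc (δG x x'') _))
    step-□ {x , y} (x'' , y'') (inj₂ (refl , e)) = +-monoˡ-≤ (δH y y'') (δ-step MG x'' e)

ascendʷ : ∀ {k} (R : Fin k → Fin k → Set) → (∀ {i j : Fin k} → suc (toℕ i) ≡ toℕ j → R i j) →
          ∀ d (i j : Fin k) → toℕ j ≡ toℕ i + d → Walk (record { V = Fin k ; Adj = R }) i j d
ascendʷ R succ zero    i j j≡i+0 = subst (λ j → Walk _ i j 0) (toℕ-injective (trans (sym (+-identityʳ _)) (sym j≡i+0))) here
ascendʷ R succ (suc d) i j j≡i+d = step (succ (sym (toℕ-fromℕ< i+1<k))) (ascendʷ R succ d (fromℕ< i+1<k) j j≡i+1+d)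
  where
  i+1<k : suc (toℕ i) < _
  i+1<k = ≤-trans (s≤s (≤-trans (m≤m+n (suc (toℕ i)) d) (≤-reflexive (trans (sym (+-suc (toℕ i) d)) (sym j≡i+d))))) (toℕ<n j)
  j≡i+1+d : toℕ j ≡ toℕ (fromℕ< i+1<k) + d
  j≡i+1+d = trans j≡i+d (trans (+-suc (toℕ i) d) (cong (_+ d) (sym (toℕ-fromℕ< i+1<k))))

∣m-1+m∣≡1 : ∀ m → ∣ m - suc m ∣ ≡ 1
∣m-1+m∣≡1 zero    = refl
∣m-1+m∣≡1 (suc m) = ∣m-1+m∣≡1 m

∣1+m-m∣≡1 : ∀ m → ∣ suc m - m ∣ ≡ 1
∣1+m-m∣≡1 m = trans (∣-∣-comm (suc m) m) (∣m-1+m∣≡1 m)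

∣m+n-m∣≡n : ∀ m n → ∣ m + n - m ∣ ≡ n
∣m+n-m∣≡n m n = trans (∣-∣-comm (m + n) m) (∣m-m+n∣≡n m n)

∣m-n∣≤1+∣1+m-n∣ : ∀ m n → ∣ m - n ∣ ≤ suc ∣ suc m - n ∣
∣m-n∣≤1+∣1+m-n∣ m n = ≤-trans (∣-∣-triangle m (suc m) n) (+-monoˡ-≤ ∣ suc m - n ∣ (≤-reflexive (∣m-1+m∣≡1 m)))

∣1+m-n∣≤1+∣m-n∣ : ∀ m n → ∣ suc m - n ∣ ≤ suc ∣ m - n ∣
∣1+m-n∣≤1+∣m-n∣ m n = ≤-trans (∣-∣-triangle (suc m) m n) (+-monoˡ-≤ ∣ m - n ∣ (≤-reflexive (∣1+m-m∣≡1 m)))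

module PathMetric (m : ℕ) where

  P-sym : ∀ {a b} → Adj (P m) a b → Adj (P m) b a
  P-sym (inj₁ e) = inj₂ e
  P-sym (inj₂ e) = inj₁ e

  path-geodesic : ∀ (i j : Fin m) → Walk (P m) i j ∣ toℕ i - toℕ j ∣
  path-geodesic i j with ≤-total (toℕ i) (toℕ j)
  ... | inj₁ i≤j = castʷ (sym (m≤n⇒∣m-n∣≡n∸m i≤j))
                     (ascendʷ _ inj₁ _ i j (sym (m+[n∸m]≡n i≤j)))
  ... | inj₂ j≤i = castʷ (sym (m≤n⇒∣n-m∣≡n∸m j≤i))
                     (reverseʷ P-sym (ascendʷ _ inj₁ _ j i (sym (m+[n∸m]≡n j≤i))))

  path-step : ∀ {i i'} (j : Fin m) → Adj (P m) i i' → ∣ toℕ i - toℕ j ∣ ≤ suc ∣ toℕ i' - toℕ j ∣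
  path-step {i} j (inj₁ e) = subst (λ t → ∣ toℕ i - toℕ j ∣ ≤ suc ∣ t - toℕ j ∣) e (∣m-n∣≤1+∣1+m-n∣ (toℕ i) (toℕ j))
  path-step {i' = i'} j (inj₂ e) = subst (λ t → ∣ t - toℕ j ∣ ≤ suc ∣ toℕ i' - toℕ j ∣) e (∣1+m-n∣≤1+∣m-n∣ (toℕ i') (toℕ j))

  pathMetric : Metric (P m)
  pathMetric = record
    { δ        = λ i j → ∣ toℕ i - toℕ j ∣
    ; geodesic = path-geodesic
    ; δ-refl   = λ i → ∣n-n∣≡0 (toℕ i)
    ; δ-step   = path-step
    }

m∸n≤1+m∸o : ∀ m {n o} → o ≤ suc n → m ∸ n ≤ suc (m ∸ o)
m∸n≤1+m∸o m       {n}     {zero}        _         = ≤-trans (m∸n≤m m n) (n≤1+n m)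
m∸n≤1+m∸o m       {zero}  {suc zero}    _         = m≤n+m∸n m 1
m∸n≤1+m∸o m       {zero}  {suc (suc o)} (s≤s ())
m∸n≤1+m∸o zero    {suc n} {suc o}       _         = z≤n
m∸n≤1+m∸o (suc m) {suc n} {suc o}       (s≤s o≤n) = m∸n≤1+m∸o m o≤n

Near : ℕ → ℕ → Set
Near a b = a ≤ suc b × b ≤ suc a

module CycleMetric (n₁ : ℕ) where

  n : ℕ
  n = suc n₁

  -- Two points of C n whose labels differ by d ≤ n are cycD d apart.
  cycD : ℕ → ℕ
  cycD d = d ⊓ (n ∸ d)

  cyc : ℕ → ℕ → ℕ
  cyc a b = cycD ∣ a - b ∣

  cyc-comm : ∀ a b → cyc a b ≡ cyc b a
  cyc-comm a b = cong cycD (∣-∣-comm a b)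

  cycD-compl : ∀ d → d ≤ n → cycD (n ∸ d) ≡ cycD d
  cycD-compl d d≤n = trans (cong ((n ∸ d) ⊓_) (m∸[m∸n]≡n d≤n)) (⊓-comm (n ∸ d) d)

  -- suc a ⊓ suc b is suc (a ⊓ b) by definition, so monotonicity of ⊓ suffices.
  cycD-near : ∀ {d d'} → Near d d' → Near (cycD d) (cycD d')
  cycD-near (d≤ , d'≤) = ⊓-mono-≤ d≤ (m∸n≤1+m∸o n d'≤) , ⊓-mono-≤ d'≤ (m∸n≤1+m∸o n d≤)

  C-sym : ∀ {a b} → Adj (C n) a b → Adj (C n) b a
  C-sym (inj₁ s) = inj₂ s
  C-sym (inj₂ s) = inj₁ s

  ascendᶜ : ∀ d (a b : Fin n) → toℕ b ≡ toℕ a + d → Walk (C n) a b d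
  ascendᶜ = ascendʷ _ (λ e → inj₁ (inj₁ e))

  last : Fin n
  last = fromℕ< ≤-refl

  wrap-edge : Adj (C n) Fin.zero last
  wrap-edge = inj₂ (inj₂ (cong suc (toℕ-fromℕ< ≤-refl) , refl))

  around-length : ∀ {a b} → a ≤ b → b ≤ n₁ → suc (a + (n₁ ∸ b)) ≡ n ∸ (b ∸ a)
  around-length {a} {b} a≤b b≤n₁ = sym (begin
    suc n₁ ∸ d                 ≡⟨ cong (λ t → suc t ∸ d) (sym (m+[n∸m]≡n b≤n₁)) ⟩
    suc (b + r) ∸ d            ≡⟨ cong (λ t → suc (t + r) ∸ d) (sym (m+[n∸m]≡n a≤b)) ⟩
    suc ((a + d) + r) ∸ d      ≡⟨ cong (λ t → suc t ∸ d) (trans (+-assoc a d r) (trans (cong (a +_) (+-comm d r)) (sym (+-assoc a r d)))) ⟩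
    (suc (a + r) + d) ∸ d      ≡⟨ m+n∸n≡m (suc (a + r)) d ⟩
    suc (a + r)                ∎)
    where
    open ≡-Reasoning
    d = b ∸ a
    r = n₁ ∸ b

  aroundʷ : ∀ (a b : Fin n) → toℕ a ≤ toℕ b → Walk (C n) a b (n ∸ (toℕ b ∸ toℕ a))
  aroundʷ a b a≤b = castʷ (trans (+-suc (toℕ a) _) (around-length a≤b b≤n₁))
    (reverseʷ C-sym (ascendᶜ (toℕ a) Fin.zero a refl) ++ʷ
     step wrap-edge (reverseʷ C-sym (ascendᶜ (n₁ ∸ toℕ b) b last last≡)))
    where
    b≤n₁ = ≤-pred (toℕ<n b)
    last≡ : toℕ last ≡ toℕ b + (n₁ ∸ toℕ b)
    last≡ = trans (toℕ-fromℕ< ≤-refl) (sym (m+[n∸m]≡n b≤n₁))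

  geodesic-≤ : ∀ (a b : Fin n) → toℕ a ≤ toℕ b → Walk (C n) a b (cyc (toℕ a) (toℕ b))
  geodesic-≤ a b a≤b with ≤-total (toℕ b ∸ toℕ a) (n ∸ (toℕ b ∸ toℕ a))
  ... | inj₁ short = castʷ (sym (trans (cong cycD (m≤n⇒∣m-n∣≡n∸m a≤b)) (m≤n⇒m⊓n≡m short)))
                       (ascendᶜ _ a b (sym (m+[n∸m]≡n a≤b)))
  ... | inj₂ long  = castʷ (sym (trans (cong cycD (m≤n⇒∣m-n∣≡n∸m a≤b)) (m≥n⇒m⊓n≡n long)))
                       (aroundʷ a b a≤b)

  cycle-geodesic : ∀ (a b : Fin n) → Walk (C n) a b (cyc (toℕ a) (toℕ b))
  cycle-geodesic a b with ≤-total (toℕ a) (toℕ b)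
  ... | inj₁ a≤b = geodesic-≤ a b a≤b
  ... | inj₂ b≤a = castʷ (cyc-comm (toℕ b) (toℕ a)) (reverseʷ C-sym (geodesic-≤ b a b≤a))

  cyc-near : ∀ {a a'} c → c ≤ n₁ → suc a ≡ a' ⊎ (suc a ≡ n × a' ≡ 0) → Near (cyc a c) (cyc a' c)
  cyc-near {a} c c≤n₁ (inj₁ refl) = cycD-near (∣m-n∣≤1+∣1+m-n∣ a c , ∣1+m-n∣≤1+∣m-n∣ a c)
  cyc-near c c≤n₁ (inj₂ (refl , refl)) rewrite m≤n⇒∣n-m∣≡n∸m c≤n₁ =
    subst (λ t → Near t (cycD c)) (sym (cycD-compl (suc c) (s≤s c≤n₁))) (cycD-near (≤-refl , m≤n+m c 2))

  cycle-step : ∀ {a a'} (c : Fin n) → Adj (C n) a a' → cyc (toℕ a) (toℕ c) ≤ suc (cyc (toℕ a') (toℕ c))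
  cycle-step c (inj₁ s) = proj₁ (cyc-near (toℕ c) (≤-pred (toℕ<n c)) s)
  cycle-step c (inj₂ s) = proj₂ (cyc-near (toℕ c) (≤-pred (toℕ<n c)) s)

  cycleMetric : Metric (C n)
  cycleMetric = record
    { δ        = λ a b → cyc (toℕ a) (toℕ b)
    ; geodesic = cycle-geodesic
    ; δ-refl   = λ a → cong cycD (∣n-n∣≡0 (toℕ a))
    ; δ-step   = cycle-step
    }

-- Symmetries and normal forms of the cylinder

∣m+o-n+o∣≡∣m-n∣ : ∀ m n o → ∣ m + o - n + o ∣ ≡ ∣ m - n ∣
∣m+o-n+o∣≡∣m-n∣ m n o = trans (cong₂ ∣_-_∣ (+-comm m o) (+-comm n o)) (∣m+n-m+o∣≡∣n-o∣ o m n)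

∣-∣-reflect : ∀ {N} x y x' y' → x' + x ≡ N → y' + y ≡ N → ∣ x' - y' ∣ ≡ ∣ x - y ∣
∣-∣-reflect {N} x y x' y' x'+x≡N y'+y≡N = begin
  ∣ x' - y' ∣                      ≡⟨ ∣m+o-n+o∣≡∣m-n∣ x' y' (x + y) ⟨
  ∣ x' + (x + y) - y' + (x + y) ∣  ≡⟨ cong₂ ∣_-_∣ (trans (sym (+-assoc x' x y)) (cong (_+ y) x'+x≡N))
                                                   (trans (cong (y' +_) (+-comm x y)) (trans (sym (+-assoc y' y x)) (cong (_+ x) y'+y≡N))) ⟩
  ∣ N + y - N + x ∣                ≡⟨ ∣m+n-m+o∣≡∣n-o∣ N y x ⟩
  ∣ y - x ∣                        ≡⟨ ∣-∣-comm y x ⟩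
  ∣ x - y ∣                        ∎
  where open ≡-Reasoning

module CycleSymmetries (n₁ : ℕ) where
  open CycleMetric n₁

  ∣-∣<n : ∀ x y → x < n → y < n → ∣ x - y ∣ ≤ n
  ∣-∣<n x y x<n y<n = ≤-trans (∣m-n∣≤m⊔n x y) (<⇒≤ (⊔-lub x<n y<n))

  cyc-+n : ∀ a {b} → b < n → ∣ a + n - b ∣ ≤ n → cyc (a + n) b ≡ cyc a b
  cyc-+n a {b} b<n a+n-b≤n = begin
    cycD ∣ a + n - b ∣  ≡⟨ cong cycD (m≤n⇒∣n-m∣≡n∸m b≤a+n) ⟩
    cycD (a + n ∸ b)    ≡⟨ cong (λ t → cycD (a + n ∸ t)) (sym (m+[n∸m]≡n a≤b)) ⟩
    cycD (a + n ∸ (a + (b ∸ a))) ≡⟨ cong cycD ([m+n]∸[m+o]≡n∸o a n (b ∸ a)) ⟩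
    cycD (n ∸ (b ∸ a))  ≡⟨ cycD-compl (b ∸ a) (≤-trans (m∸n≤m b a) (<⇒≤ b<n)) ⟩
    cycD (b ∸ a)        ≡⟨ cong cycD (m≤n⇒∣m-n∣≡n∸m a≤b) ⟨
    cycD ∣ a - b ∣      ∎
    where
    open ≡-Reasoning
    b≤a+n : b ≤ a + n
    b≤a+n = ≤-trans (<⇒≤ b<n) (m≤n+m n a)
    a≤b : a ≤ b
    a≤b = +-cancelʳ-≤ n a b (≤-trans (≤-reflexive (sym (m+[n∸m]≡n b≤a+n)))
            (+-monoʳ-≤ b (≤-trans (≤-reflexive (sym (m≤n⇒∣n-m∣≡n∸m b≤a+n))) a+n-b≤n)))

  -- x + s ≡ x' modulo n, with at most one wrap-around.
  data Shift (s x : ℕ) : ℕ → Set where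
    unwrapped : ∀ {x'} → x + s ≡ x'     → Shift s x x'
    wrapped   : ∀ {x'} → x + s ≡ x' + n → Shift s x x'

  cyc-shift-wrap : ∀ {s x y x' y'} → x < n → y < n → y' < n → x + s ≡ x' + n → y + s ≡ y' → cyc x' y' ≡ cyc x y
  cyc-shift-wrap {s} {x} {y} {x'} {y'} x<n y<n y'<n x+s≡ refl =
    trans (sym (cyc-+n x' y'<n (subst (_≤ n) (sym ∣x'+n-y'∣) (∣-∣<n x y x<n y<n)))) (cong cycD ∣x'+n-y'∣)
    where
    ∣x'+n-y'∣ : ∣ x' + n - y + s ∣ ≡ ∣ x - y ∣
    ∣x'+n-y'∣ = trans (cong ∣_- y + s ∣ (sym x+s≡)) (∣m+o-n+o∣≡∣m-n∣ x y s)

  cyc-shift : ∀ {s x y x' y'} → x < n → y < n → x' < n → y' < n → Shift s x x' → Shift s y y' → cyc x' y' ≡ cyc x y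
  cyc-shift {s} {x} {y} x<n y<n _ _ (unwrapped refl) (unwrapped refl) = cong cycD (∣m+o-n+o∣≡∣m-n∣ x y s)
  cyc-shift {s} {x} {y} {x'} {y'} x<n y<n _ _ (wrapped x+s≡) (wrapped y+s≡) =
    cong cycD (trans (sym (∣m+o-n+o∣≡∣m-n∣ x' y' n)) (trans (cong₂ ∣_-_∣ (sym x+s≡) (sym y+s≡)) (∣m+o-n+o∣≡∣m-n∣ x y s)))
  cyc-shift x<n y<n _ y'<n (wrapped x+s≡) (unwrapped y+s≡) = cyc-shift-wrap x<n y<n y'<n x+s≡ y+s≡
  cyc-shift {x = x} {y} {x'} {y'} x<n y<n x'<n _ (unwrapped x+s≡) (wrapped y+s≡) =
    trans (cyc-comm x' y') (trans (cyc-shift-wrap y<n x<n x'<n y+s≡ x+s≡) (cyc-comm y x))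

  shift-unique : ∀ {s x r r'} → r < n → r' < n → Shift s x r → Shift s x r' → r ≡ r'
  shift-unique _   _    (unwrapped e) (unwrapped e') = trans (sym e) e'
  shift-unique r<n _    (unwrapped e) (wrapped e') = ⊥-elim (<-irrefl refl (≤-trans r<n (≤-trans (m≤n+m n _) (≤-reflexive (trans (sym e') e)))))
  shift-unique _   r'<n (wrapped e) (unwrapped e') = ⊥-elim (<-irrefl refl (≤-trans r'<n (≤-trans (m≤n+m n _) (≤-reflexive (trans (sym e) e')))))
  shift-unique _   _    (wrapped e) (wrapped e') = +-cancelʳ-≡ n _ _ (trans (sym e) e')

  rotation : ∀ s → s < n → (q : Fin n) → Σ (Fin n) λ q' → Shift s (toℕ q) (toℕ q')
  rotation s s<n q with toℕ q + s <? n
  ... | yes q+s<n = fromℕ< q+s<n , unwrapped (sym (toℕ-fromℕ< q+s<n))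
  ... | no  q+s≮n = fromℕ< wrapped<n , wrapped (sym (trans (cong (_+ n) (toℕ-fromℕ< wrapped<n)) (m∸n+n≡m n≤q+s)))
    where
    n≤q+s = ≮⇒≥ q+s≮n
    wrapped<n : toℕ q + s ∸ n < n
    wrapped<n = +-cancelʳ-< n _ n (subst (_< n + n) (sym (m∸n+n≡m n≤q+s)) (+-mono-< (toℕ<n q) s<n))

  rotate : ∀ s → s < n → Fin n → Fin n
  rotate s s<n q = proj₁ (rotation s s<n q)

  rotate-shift : ∀ s s<n q → Shift s (toℕ q) (toℕ (rotate s s<n q))
  rotate-shift s s<n q = proj₂ (rotation s s<n q)

  rotate-isometry : ∀ s s<n → IsIsometry cycleMetric (rotate s s<n)
  rotate-isometry s s<n a b = cyc-shift (toℕ<n a) (toℕ<n b) (toℕ<n _) (toℕ<n _) (rotate-shift s s<n a) (rotate-shift s s<n b)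

  rotate-value : ∀ s s<n q {v} → v < n → Shift s (toℕ q) v → toℕ (rotate s s<n q) ≡ v
  rotate-value s s<n q v<n sh = shift-unique (toℕ<n _) v<n (rotate-shift s s<n q) sh

  -- x' ≡ - x modulo n.
  data Reflect : ℕ → ℕ → Set where
    reflect-zero : Reflect 0 0
    reflect-pos  : ∀ {x x'} → x' + x ≡ n → Reflect x x'

  cyc-reflect : ∀ {x y x' y'} → x < n → y < n → Reflect x x' → Reflect y y' → cyc x' y' ≡ cyc x y
  cyc-reflect _   _   reflect-zero reflect-zero = refl
  cyc-reflect {x} {y} {x'} {y'} _ _ (reflect-pos x'+x≡n) (reflect-pos y'+y≡n) = cong cycD (∣-∣-reflect x y x' y' x'+x≡n y'+y≡n)
  cyc-reflect {y = y} {y' = y'} _ y<n reflect-zero (reflect-pos y'+y≡n) =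
    trans (cong cycD (sym (trans (cong (_∸ y) (sym y'+y≡n)) (m+n∸n≡m y' y)))) (cycD-compl y (<⇒≤ y<n))
  cyc-reflect {x} {x' = x'} x<n y<n (reflect-pos x'+x≡n) reflect-zero =
    trans (cyc-comm x' 0) (trans (cyc-reflect y<n x<n reflect-zero (reflect-pos x'+x≡n)) (cyc-comm 0 x))

  reflect-unique : ∀ {x r r'} → r < n → r' < n → Reflect x r → Reflect x r' → r ≡ r'
  reflect-unique _   _    reflect-zero reflect-zero = refl
  reflect-unique _   r'<n reflect-zero (reflect-pos r'+0≡n) = ⊥-elim (<-irrefl (trans (sym (+-identityʳ _)) r'+0≡n) r'<n)
  reflect-unique r<n _    (reflect-pos r+0≡n) reflect-zero = ⊥-elim (<-irrefl (trans (sym (+-identityʳ _)) r+0≡n) r<n)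
  reflect-unique _   _    (reflect-pos e) (reflect-pos e') = +-cancelʳ-≡ _ _ _ (trans e (sym e'))

  reflection : (q : Fin n) → Σ (Fin n) λ q' → Reflect (toℕ q) (toℕ q')
  reflection Fin.zero    = Fin.zero , reflect-zero
  reflection (Fin.suc q) = fromℕ< n-q<n , reflect-pos (trans (cong (_+ suc (toℕ q)) (toℕ-fromℕ< n-q<n)) (m∸n+n≡m (<⇒≤ (toℕ<n (Fin.suc q)))))
    where
    n-q<n : n ∸ suc (toℕ q) < n
    n-q<n = ∸-monoʳ-< z<s (<⇒≤ (toℕ<n (Fin.suc q)))

  reflect : Fin n → Fin n
  reflect q = proj₁ (reflection q)

  reflect-isometry : IsIsometry cycleMetric reflect
  reflect-isometry a b = cyc-reflect (toℕ<n a) (toℕ<n b) (proj₂ (reflection a)) (proj₂ (reflection b))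

  reflect-value : ∀ q {v} → v < n → Reflect (toℕ q) v → toℕ (reflect q) ≡ v
  reflect-value q v<n rf = reflect-unique (toℕ<n _) v<n (proj₂ (reflection q)) rf

  Reflect-sym : ∀ {x x'} → Reflect x x' → Reflect x' x
  Reflect-sym reflect-zero                   = reflect-zero
  Reflect-sym {x} {x'} (reflect-pos x'+x≡n) = reflect-pos (trans (+-comm x x') x'+x≡n)

  reflect-involutive : ∀ q → reflect (reflect q) ≡ q
  reflect-involutive q = toℕ-injective (reflect-value (reflect q) (toℕ<n q) (Reflect-sym (proj₂ (reflection q))))

  -- Rotation by n₁, i.e. one step backwards.
  rotate⁻¹ : Fin n → Fin n
  rotate⁻¹ = rotate n₁ ≤-refl

  rotate⁻¹-zero : rotate⁻¹ Fin.zero ≡ fromℕ< ≤-refl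
  rotate⁻¹-zero = toℕ-injective (trans (rotate-value n₁ ≤-refl Fin.zero ≤-refl (unwrapped refl)) (sym (toℕ-fromℕ< ≤-refl)))

  rotate⁻¹-suc : ∀ {b} (b<n : b < n) .(1+b<n : suc b < n) → rotate⁻¹ (fromℕ< 1+b<n) ≡ fromℕ< b<n
  rotate⁻¹-suc {b} b<n 1+b<n = toℕ-injective (trans (rotate-value n₁ ≤-refl _ b<n shift) (sym (toℕ-fromℕ< b<n)))
    where
    shift : Shift n₁ (toℕ (fromℕ< 1+b<n)) b
    shift = wrapped (trans (cong (_+ n₁) (toℕ-fromℕ< 1+b<n)) (sym (+-suc b n₁)))

module Cylinder (m n₁ : ℕ) where
  open PathMetric m public
  open CycleMetric n₁ public
  open CycleSymmetries n₁ public

  Cyl : Graph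
  Cyl = P m □ C n

  cylinderMetric : Metric Cyl
  cylinderMetric = pathMetric □ᵐ cycleMetric

  open MetricProperties cylinderMetric (□-sym P-sym C-sym) public

  opposite-isometry : IsIsometry pathMetric opposite
  opposite-isometry a b = ∣-∣-reflect (toℕ a) (toℕ b) _ _ (opposite+id a) (opposite+id b)
    where
    opposite+id : ∀ i → toℕ (opposite i) + toℕ i ≡ pred m
    opposite+id i = trans (cong (_+ toℕ i) (opposite-prop i))
                      (cong pred (trans (sym (+-suc (m ∸ suc (toℕ i)) (toℕ i))) (m∸n+n≡m (toℕ<n i))))

  -- A product of isometries of the two factors, used as a coordinate system.
  record Frame : Set where
    field
      pathMap           : Fin m → Fin m
      cycleMap          : Fin n → Fin n
      pathMap-isometry  : IsIsometry pathMetric pathMap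
      cycleMap-isometry : IsIsometry cycleMetric cycleMap
  open Frame public

  record Coord : Set where
    constructor coord
    field
      row    : ℕ
      .row<m : row < m
      col    : ℕ
      .col<n : col < n
  open Coord public

  _⊙_ : Frame → Coord → V Cyl
  F ⊙ coord a a<m b b<n = pathMap F (fromℕ< a<m) , cycleMap F (fromℕ< b<n)

  δ-frame : ∀ F P Q {p q} → ∣ row P - row Q ∣ ≡ p → cyc (col P) (col Q) ≡ q → δ (F ⊙ P) (F ⊙ Q) ≡ p + q
  δ-frame F (coord a a<m b b<n) (coord a' a'<m b' b'<n) ∣a-a'∣≡p cyc≡q =
    cong₂ _+_ (trans (pathMap-isometry F _ _) (trans (cong₂ ∣_-_∣ (toℕ-fromℕ< a<m) (toℕ-fromℕ< a'<m)) ∣a-a'∣≡p))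
              (trans (cycleMap-isometry F _ _) (trans (cong₂ cyc (toℕ-fromℕ< b<n) (toℕ-fromℕ< b'<n)) cyc≡q))

  ⊙-cong : ∀ F {a a' b b'} .{a<m : a < m} .{a'<m : a' < m} .{b<n : b < n} .{b'<n : b' < n} →
           a ≡ a' → b ≡ b' → F ⊙ coord a a<m b b<n ≡ F ⊙ coord a' a'<m b' b'<n
  ⊙-cong F refl refl = refl

  rotated : Frame → Frame
  rotated F = record
    { pathMap = pathMap F ; cycleMap = λ q → cycleMap F (rotate⁻¹ q)
    ; pathMap-isometry = pathMap-isometry F
    ; cycleMap-isometry = λ a b → trans (cycleMap-isometry F (rotate⁻¹ a) (rotate⁻¹ b)) (rotate-isometry n₁ ≤-refl a b) }

  record PathNormal (ix iz : Fin m) : Set where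
    field
      f          : Fin m → Fin m
      f-isometry : IsIsometry pathMetric f
      i Δ        : ℕ
      i+Δ<m      : i + Δ < m
      f-i        : f (fromℕ< (≤-<-trans (m≤m+n i Δ) i+Δ<m)) ≡ ix
      f-i+Δ      : f (fromℕ< i+Δ<m) ≡ iz

  pathNormal : ∀ ix iz → PathNormal ix iz
  pathNormal ix iz with ≤-total (toℕ ix) (toℕ iz)
  ... | inj₁ ix≤iz = record
    { f = λ a → a ; f-isometry = λ _ _ → refl ; i = toℕ ix ; Δ = toℕ iz ∸ toℕ ix
    ; i+Δ<m = subst (_< m) (sym (m+[n∸m]≡n ix≤iz)) (toℕ<n iz)
    ; f-i = fromℕ<-toℕ ix _
    ; f-i+Δ = toℕ-injective (trans (toℕ-fromℕ< _) (m+[n∸m]≡n ix≤iz)) }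
  ... | inj₂ iz≤ix = record
    { f = opposite ; f-isometry = opposite-isometry ; i = toℕ (opposite ix) ; Δ = toℕ ix ∸ toℕ iz
    ; i+Δ<m = subst (_< m) (sym opposite-ix+Δ) (toℕ<n (opposite iz))
    ; f-i = trans (cong opposite (fromℕ<-toℕ (opposite ix) _)) (opposite-involutive ix)
    ; f-i+Δ = trans (cong opposite (toℕ-injective (trans (toℕ-fromℕ< _) opposite-ix+Δ))) (opposite-involutive iz) }
    where
    opposite-ix+Δ : toℕ (opposite ix) + (toℕ ix ∸ toℕ iz) ≡ toℕ (opposite iz)
    opposite-ix+Δ = begin
      toℕ (opposite ix) + (toℕ ix ∸ toℕ iz)    ≡⟨ cong (_+ (toℕ ix ∸ toℕ iz)) (opposite-prop ix) ⟩
      m ∸ suc (toℕ ix) + (toℕ ix ∸ toℕ iz)     ≡⟨ cong (λ t → m ∸ suc t + (toℕ ix ∸ toℕ iz)) (sym (m+[n∸m]≡n iz≤ix)) ⟩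
      m ∸ suc (toℕ iz + d) + d                  ≡⟨ cong (_+ d) (sym (∸-+-assoc m (suc (toℕ iz)) d)) ⟩
      m ∸ suc (toℕ iz) ∸ d + d                  ≡⟨ m∸n+n≡m d≤ ⟩
      m ∸ suc (toℕ iz)                          ≡⟨ opposite-prop iz ⟨
      toℕ (opposite iz)                         ∎
      where
      open ≡-Reasoning
      d = toℕ ix ∸ toℕ iz
      d≤ : d ≤ m ∸ suc (toℕ iz)
      d≤ = m+n≤o⇒m≤o∸n d (subst (_≤ m) (trans (cong suc (sym (m∸n+n≡m iz≤ix))) (sym (+-suc d (toℕ iz)))) (toℕ<n ix))

  difference : (a b : Fin n) → Σ (Fin n) λ d → Shift (toℕ a) (toℕ d) (toℕ b)
  difference a b with toℕ a ≤? toℕ b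
  ... | yes a≤b = fromℕ< b-a<n , unwrapped (trans (cong (_+ toℕ a) (toℕ-fromℕ< b-a<n)) (m∸n+n≡m a≤b))
    where
    b-a<n : toℕ b ∸ toℕ a < n
    b-a<n = ≤-<-trans (m∸n≤m (toℕ b) (toℕ a)) (toℕ<n b)
  ... | no  a≰b = fromℕ< b+n-a<n , wrapped (trans (cong (_+ toℕ a) (toℕ-fromℕ< b+n-a<n)) (m∸n+n≡m a≤b+n))
    where
    a≤b+n : toℕ a ≤ toℕ b + n
    a≤b+n = ≤-trans (<⇒≤ (toℕ<n a)) (m≤n+m n (toℕ b))
    b+n-a<n : toℕ b + n ∸ toℕ a < n
    b+n-a<n = m<n+o⇒m∸n<o (toℕ b + n) (toℕ a) (+-monoˡ-< n (≰⇒> a≰b))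

module EvenCylinder (m n₁ h : ℕ) (n≡h+h : suc n₁ ≡ h + h) where
  open Cylinder m n₁ public

  h<n : h < n
  h<n = subst (h <_) (sym n≡h+h) (m<m+n h (positive n≡h+h))
    where
    positive : ∀ {k} → suc n₁ ≡ k + k → 0 < k
    positive {zero}  ()
    positive {suc k} _ = z<s

  ≤h⇒<n : ∀ {d} → d ≤ h → d < n
  ≤h⇒<n d≤h = ≤-<-trans d≤h h<n

  cycD-≤h : ∀ {d} → d ≤ h → cycD d ≡ d
  cycD-≤h {d} d≤h = m≤n⇒m⊓n≡m (m+n≤o⇒m≤o∸n d (≤-trans (+-mono-≤ d≤h d≤h) (≤-reflexive (sym n≡h+h))))

  cyc-shift-value : ∀ a b {d} → d ≤ h → Shift d a b → cyc a b ≡ d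
  cyc-shift-value a _ {d} d≤h (unwrapped refl) = trans (cong cycD (∣m-m+n∣≡n a d)) (cycD-≤h d≤h)
  cyc-shift-value a b {d} d≤h (wrapped a+d≡b+n) =
    trans (cong cycD ∣a-b∣≡n-d) (trans (cycD-compl d (<⇒≤ (≤h⇒<n d≤h))) (cycD-≤h d≤h))
    where
    b≤a : b ≤ a
    b≤a = +-cancelʳ-≤ n b a (≤-trans (≤-reflexive (sym a+d≡b+n)) (+-monoʳ-≤ a (<⇒≤ (≤h⇒<n d≤h))))
    a-b+d≡n : (a ∸ b) + d ≡ n
    a-b+d≡n = +-cancelˡ-≡ b _ _ (trans (sym (+-assoc b (a ∸ b) d)) (trans (cong (_+ d) (m+[n∸m]≡n b≤a)) a+d≡b+n))
    ∣a-b∣≡n-d : ∣ a - b ∣ ≡ n ∸ d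
    ∣a-b∣≡n-d = trans (m≤n⇒∣n-m∣≡n∸m b≤a) (trans (sym (m+n∸n≡m (a ∸ b) d)) (cong (_∸ d) a-b+d≡n))

  cyc-shift-value′ : ∀ a b {d} → d ≤ h → Shift d b a → cyc a b ≡ d
  cyc-shift-value′ a b d≤h sh = trans (cyc-comm a b) (cyc-shift-value b a d≤h sh)

  Reflect-≤h : ∀ {x x'} → h < x → Reflect x x' → x' ≤ h
  Reflect-≤h {x} {x'} h<x (reflect-pos x'+x≡n) =
    +-cancelʳ-≤ x x' h (≤-trans (≤-reflexive (trans x'+x≡n n≡h+h)) (+-monoʳ-≤ h (<⇒≤ h<x)))

  record CycleNormal (ax az : Fin n) : Set where
    field
      f          : Fin n → Fin n
      f-isometry : IsIsometry cycleMetric f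
      e          : ℕ
      e≤h        : e ≤ h
      f-0        : f Fin.zero ≡ ax
      f-e        : f (fromℕ< (≤h⇒<n e≤h)) ≡ az

  -- Rotate ax to 0, then reflect if az lies more than half-way round.
  cycleNormal : ∀ ax az → CycleNormal ax az
  cycleNormal ax az with difference ax az
  ... | d , ax+d≡az with toℕ d ≤? h
  ...   | yes d≤h = record
    { f = ρ ; f-isometry = rotate-isometry _ _ ; e = toℕ d ; e≤h = d≤h
    ; f-0 = toℕ-injective (rotate-value _ _ Fin.zero (toℕ<n ax) (unwrapped refl))
    ; f-e = trans (cong ρ (fromℕ<-toℕ d _)) (toℕ-injective (rotate-value _ _ d (toℕ<n az) ax+d≡az)) }
    where ρ = rotate (toℕ ax) (toℕ<n ax)
  ...   | no  d≰h = record
    { f = λ q → ρ (reflect q) ; f-isometry = λ a b → trans (rotate-isometry _ _ (reflect a) (reflect b)) (reflect-isometry a b)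
    ; e = toℕ (reflect d) ; e≤h = Reflect-≤h (≰⇒> d≰h) (proj₂ (reflection d))
    ; f-0 = toℕ-injective (rotate-value _ _ Fin.zero (toℕ<n ax) (unwrapped refl))
    ; f-e = trans (cong (λ q → ρ (reflect q)) (fromℕ<-toℕ (reflect d) _))
              (trans (cong ρ (reflect-involutive d)) (toℕ-injective (rotate-value _ _ d (toℕ<n az) ax+d≡az))) }
    where ρ = rotate (toℕ ax) (toℕ<n ax)

  record Normalised (x z : V Cyl) : Set where
    field
      frame : Frame
      i Δ e : ℕ
      i+Δ<m : i + Δ < m
      e≤h   : e ≤ h
      x≡    : frame ⊙ coord i (≤-<-trans (m≤m+n i Δ) i+Δ<m) 0 z<s ≡ x
      z≡    : frame ⊙ coord (i + Δ) i+Δ<m e (≤h⇒<n e≤h) ≡ z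

  normalise : ∀ x z → Normalised x z
  normalise (ix , ax) (iz , az) = record
    { frame = record { pathMap = PathNormal.f p ; cycleMap = CycleNormal.f q
                     ; pathMap-isometry = PathNormal.f-isometry p ; cycleMap-isometry = CycleNormal.f-isometry q }
    ; i = PathNormal.i p ; Δ = PathNormal.Δ p ; e = CycleNormal.e q
    ; i+Δ<m = PathNormal.i+Δ<m p ; e≤h = CycleNormal.e≤h q
    ; x≡ = cong₂ _,_ (PathNormal.f-i p) (CycleNormal.f-0 q)
    ; z≡ = cong₂ _,_ (PathNormal.f-i+Δ p) (CycleNormal.f-e q) }
    where
    p = pathNormal ix iz
    q = cycleNormal ax az

-- Colours along a walk

colours-exhausted : ∀ (X Y Z κ : Fin 3) → X ≢ Y → Y ≢ Z → X ≢ Z → κ ≢ Y → κ ≢ Z → κ ≡ X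
colours-exhausted = from-yes (all? λ (X : Fin 3) → all? λ (Y : Fin 3) → all? λ (Z : Fin 3) → all? λ (κ : Fin 3) →
  ¬? (X ≟ᶠ Y) →-dec ¬? (Y ≟ᶠ Z) →-dec ¬? (X ≟ᶠ Z) →-dec ¬? (κ ≟ᶠ Y) →-dec ¬? (κ ≟ᶠ Z) →-dec κ ≟ᶠ X)

third-colour : ∀ (a b : Fin 3) → ∃ λ κ → κ ≢ a × κ ≢ b
third-colour = from-yes (all? λ (a : Fin 3) → all? λ (b : Fin 3) → any? λ (κ : Fin 3) → ¬? (κ ≟ᶠ a) ×-dec ¬? (κ ≟ᶠ b))

two-colours : ∀ (a b c : Fin 2) → a ≢ b → b ≢ c → a ≡ c
two-colours = from-yes (all? λ (a : Fin 2) → all? λ (b : Fin 2) → all? λ (c : Fin 2) → ¬? (a ≟ᶠ b) →-dec ¬? (b ≟ᶠ c) →-dec a ≟ᶠ c)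

module Windows (col : ℕ → Fin 3) where

  Occurs : Fin 3 → ℕ → ℕ → Set
  Occurs κ l r = ∃ λ t → l ≤ t × t ≤ r × col t ≡ κ

  Absent : Fin 3 → ℕ → ℕ → Set
  Absent κ l r = ∀ t → l ≤ t → t ≤ r → col t ≢ κ

  AllColours : ℕ → ℕ → Set
  AllColours l r = ∀ κ → Occurs κ l r

  occurs? : ∀ κ l d → Occurs κ l (l + d) ⊎ Absent κ l (l + d)
  occurs? κ l zero with col l ≟ᶠ κ
  ... | yes col-l≡κ = inj₁ (l , ≤-refl , m≤m+n l 0 , col-l≡κ)
  ... | no  col-l≢κ = inj₂ λ t l≤t t≤l+0 → subst (λ t → col t ≢ κ) (≤-antisym l≤t (≤-trans t≤l+0 (≤-reflexive (+-identityʳ l)))) col-l≢κ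
  occurs? κ l (suc d) with occurs? κ l d
  ... | inj₁ (t , l≤t , t≤l+d , col-t≡κ) = inj₁ (t , l≤t , ≤-trans t≤l+d (+-monoʳ-≤ l (n≤1+n d)) , col-t≡κ)
  ... | inj₂ absent with col (l + suc d) ≟ᶠ κ
  ...   | yes col≡κ = inj₁ (l + suc d , m≤m+n l (suc d) , ≤-refl , col≡κ)
  ...   | no  col≢κ = inj₂ λ t l≤t t≤ → absent-last t l≤t (m≤n⇒m<n∨m≡n t≤)
    where
    absent-last : ∀ t → l ≤ t → t < l + suc d ⊎ t ≡ l + suc d → col t ≢ κ
    absent-last t l≤t (inj₁ t<)   = absent t l≤t (≤-pred (subst (t <_) (+-suc l d) t<))
    absent-last t l≤t (inj₂ refl) = col≢κ

  all-colours? : ∀ l d → AllColours l (l + d) ⊎ ∃ λ κ → Absent κ l (l + d)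
  all-colours? l d with occurs? Fin.zero l d | occurs? (Fin.suc Fin.zero) l d | occurs? (Fin.suc (Fin.suc Fin.zero)) l d
  ... | inj₂ absent | _ | _ = inj₂ (_ , absent)
  ... | inj₁ _ | inj₂ absent | _ = inj₂ (_ , absent)
  ... | inj₁ _ | inj₁ _ | inj₂ absent = inj₂ (_ , absent)
  ... | inj₁ o₀ | inj₁ o₁ | inj₁ o₂ = inj₁ λ where
    Fin.zero → o₀
    (Fin.suc Fin.zero) → o₁
    (Fin.suc (Fin.suc Fin.zero)) → o₂

  record Window : Set where
    field
      start len   : ℕ
      2≤len       : 2 ≤ len
      ends-differ : col start ≢ col (start + len)
      interior    : ∀ t → start < t → t < start + len → col t ≢ col start × col t ≢ col (start + len)

  -- A shortest subinterval containing all three colours is a window.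
  window : ∀ s l → AllColours l (l + s) → Σ Window λ W → l ≤ Window.start W × Window.start W + Window.len W ≤ l + s
  window zero l all with all Fin.zero | all (Fin.suc Fin.zero)
  ... | t₀ , l≤t₀ , t₀≤l , col-t₀ | t₁ , l≤t₁ , t₁≤l , col-t₁ =
    ⊥-elim (0≢1 (trans (sym col-t₀) (trans (cong col (trans (at-l l≤t₀ t₀≤l) (sym (at-l l≤t₁ t₁≤l)))) col-t₁)))
    where
    at-l : ∀ {t} → l ≤ t → t ≤ l + 0 → t ≡ l
    at-l l≤t t≤l = ≤-antisym (≤-trans t≤l (≤-reflexive (+-identityʳ l))) l≤t
    0≢1 : Fin.zero {2} ≢ Fin.suc Fin.zero
    0≢1 ()
  window (suc s) l all with all-colours? l s
  ... | inj₁ all′ with window s l all′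
  ...   | W , l≤ , ≤l+s = W , l≤ , ≤-trans ≤l+s (+-monoʳ-≤ l (n≤1+n s))
  window (suc s) l all | inj₂ (κ₁ , κ₁-absent) with all-colours? (suc l) s
  ...   | inj₁ all′ with window s (suc l) all′
  ...     | W , l<  , ≤l+s = W , <⇒≤ l< , ≤-trans ≤l+s (≤-reflexive (sym (+-suc l s)))
  window (suc s) l all | inj₂ (κ₁ , κ₁-absent) | inj₂ (κ₂ , κ₂-absent) =
    record { start = l ; len = suc s ; 2≤len = 2≤len ; ends-differ = ends-differ ; interior = interior } , ≤-refl , ≤-refl
    where
    t≤l+s : ∀ {t} → t < l + suc s → t ≤ l + s
    t≤l+s {t} t< = ≤-pred (subst (t <_) (+-suc l s) t<)
    col-r : col (l + suc s) ≡ κ₁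
    col-r with all κ₁
    ... | t , l≤t , t≤ , col-t with m≤n⇒m<n∨m≡n t≤
    ...   | inj₂ refl = col-t
    ...   | inj₁ t<   = ⊥-elim (κ₁-absent t l≤t (t≤l+s t<) col-t)
    col-l : col l ≡ κ₂
    col-l with all κ₂
    ... | t , l≤t , t≤ , col-t with m≤n⇒m<n∨m≡n l≤t
    ...   | inj₂ refl = col-t
    ...   | inj₁ l<t  = ⊥-elim (κ₂-absent t l<t (≤-trans t≤ (≤-reflexive (+-suc l s))) col-t)
    ends-differ : col l ≢ col (l + suc s)
    ends-differ e = κ₁-absent l ≤-refl (m≤m+n l s) (trans e col-r)
    interior : ∀ t → l < t → t < l + suc s → col t ≢ col l × col t ≢ col (l + suc s)
    interior t l<t t< = (λ e → κ₂-absent t l<t (≤-trans (t≤l+s t<) (n≤1+n _)) (trans e col-l))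
                      , (λ e → κ₁-absent t (<⇒≤ l<t) (t≤l+s t<) (trans e col-r))
    -- The third colour occurs, but neither at l nor at l + suc s.
    2≤len : 2 ≤ suc s
    2≤len with third-colour κ₁ κ₂
    ... | κ₃ , κ₃≢κ₁ , κ₃≢κ₂ with all κ₃
    ...   | t , l≤t , t≤ , col-t with m≤n⇒m<n∨m≡n l≤t | m≤n⇒m<n∨m≡n t≤
    ...     | inj₂ refl | _         = ⊥-elim (κ₃≢κ₂ (trans (sym col-t) col-l))
    ...     | inj₁ _    | inj₂ refl = ⊥-elim (κ₃≢κ₁ (trans (sym col-t) col-r))
    ...     | inj₁ l<t  | inj₁ t<   = s≤s (+-cancelˡ-≤ l 1 s (≤-trans (≤-reflexive (+-comm l 1)) (≤-trans l<t (t≤l+s t<))))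

-- Layered pairs

Even Odd : ℕ → Set
Even n = ∃ λ q → n ≡ 2 * q
Odd  n = ∃ λ q → n ≡ suc (2 * q)

even-or-odd : ∀ n → Even n ⊎ Odd n
even-or-odd zero = inj₁ (0 , refl)
even-or-odd (suc n) with even-or-odd n
... | inj₁ (q , refl) = inj₂ (q , refl)
... | inj₂ (q , refl) = inj₁ (suc q , cong suc (sym (+-suc q (q + 0))))

even⇒¬odd : ∀ {n} → Even n → Odd n → ⊥
even⇒¬odd (p , n≡2p) (q , n≡1+2q) = even≢odd p q (trans (sym n≡2p) n≡1+2q)

module Rainbows {G : Graph} (M : Metric G) (adj-sym : ∀ {a b} → Adj G a b → Adj G b a) {r : ℕ} (c : V G → Fin r) where
  open MetricProperties M adj-sym

  Rainbow : Set
  Rainbow = HasRainbow3AP G c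

  rainbow : ∀ v₁ v₂ v₃ → c v₁ ≢ c v₂ → c v₂ ≢ c v₃ → c v₁ ≢ c v₃ → δ v₂ v₃ ≡ δ v₁ v₂ → Rainbow
  rainbow v₁ v₂ v₃ c₁₂ c₂₃ c₁₃ δ₂₃≡δ₁₂ = v₁ , v₂ , v₃ , (c₁₂ , c₂₃ , c₁₃) , δ v₁ v₂ , δ-dist refl , δ-dist (sym δ₂₃≡δ₁₂)

-- Pairs x, z at odd distance whose colours X, Z are separated by layers of the third colour Y
-- force a rainbow 3-AP in P m □ C (2h), provided the diameter (m - 1) + h is even.
module LayeredPairs (m n₁ h' : ℕ) (n≡h+h : suc n₁ ≡ suc (suc h') + suc (suc h')) (1<m : 1 < m)
                    (diameter-even : Even (pred m + suc (suc h')))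
                    (c : Fin m × Fin (suc n₁) → Fin 3) (X Y Z : Fin 3)
                    (X≢Y : X ≢ Y) (Y≢Z : Y ≢ Z) (X≢Z : X ≢ Z) where

  h : ℕ
  h = suc (suc h')

  open EvenCylinder m n₁ h n≡h+h
  open Rainbows cylinderMetric (□-sym P-sym C-sym) c using (Rainbow; rainbow)

  infixl 1 _⟫_
  _⟫_ : ∀ {P : Set} → Rainbow ⊎ P → (P → Rainbow) → Rainbow
  inj₁ r ⟫ _ = r
  inj₂ p ⟫ k = k p

  coloured : ∀ {v w A B} → c v ≡ A → c w ≡ B → A ≢ B → c v ≢ c w
  coloured refl refl A≢B = A≢B

  colour-cases : ∀ {A : Set} v → (c v ≡ X → A) → (c v ≡ Y → A) → (c v ≡ Z → A) → A
  colour-cases v onX onY onZ with c v ≟ᶠ Y | c v ≟ᶠ Z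
  ... | yes v-Y | _        = onY v-Y
  ... | no  _   | yes v-Z  = onZ v-Z
  ... | no  v≢Y | no  v≢Z  = onX (colours-exhausted X Y Z (c v) X≢Y Y≢Z X≢Z v≢Y v≢Z)

  record Layered (x z : V Cyl) (L : ℕ) : Set where
    field
      x-X     : c x ≡ X
      z-Z     : c z ≡ Z
      δxz     : δ x z ≡ L
      3≤L     : 3 ≤ L
      L-odd   : Odd L
      layer-x : ∀ t → 1 ≤ t → t < L → Rainbow ⊎ ∃ λ y → δ x y ≡ t × c y ≡ Y
      layer-z : ∀ t → 1 ≤ t → t < L → Rainbow ⊎ ∃ λ y → δ z y ≡ t × c y ≡ Y

  module Forcing {x z L} (C : Layered x z L) where
    open Layered C

    Z-near-x : ∀ v {t} → δ x v ≡ t → 1 ≤ t → t < L → c v ≡ Z → Rainbow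
    Z-near-x v δxv≡t 1≤t t<L v-Z = layer-x _ 1≤t t<L ⟫ λ where
      (y , δxy≡t , y-Y) → rainbow y x v (coloured y-Y x-X (≢-sym X≢Y)) (coloured x-X v-Z X≢Z) (coloured y-Y v-Z Y≢Z)
                                        (trans δxv≡t (trans (sym δxy≡t) (δ-sym x y)))

    X-near-z : ∀ v {t} → δ z v ≡ t → 1 ≤ t → t < L → c v ≡ X → Rainbow
    X-near-z v δzv≡t 1≤t t<L v-X = layer-z _ 1≤t t<L ⟫ λ where
      (y , δzy≡t , y-Y) → rainbow y z v (coloured y-Y z-Z Y≢Z) (coloured z-Z v-X (≢-sym X≢Z)) (coloured y-Y v-X (≢-sym X≢Y))
                                        (trans δzv≡t (trans (sym δzy≡t) (δ-sym z y)))

    Y-far-from-x : ∀ v → δ x v ≡ L → c v ≡ Y → Rainbow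
    Y-far-from-x v δxv≡L v-Y =
      rainbow v x z (coloured v-Y x-X (≢-sym X≢Y)) (coloured x-X z-Z X≢Z) (coloured v-Y z-Z Y≢Z) (trans δxz (sym (trans (δ-sym v x) δxv≡L)))

    Y-far-from-z : ∀ v → δ z v ≡ L → c v ≡ Y → Rainbow
    Y-far-from-z v δzv≡L v-Y =
      rainbow x z v (coloured x-X z-Z X≢Z) (coloured z-Z v-Y (≢-sym Y≢Z)) (coloured x-X v-Y X≢Y) (trans δzv≡L (sym δxz))

    forced-X : ∀ v {t} → δ z v ≡ L → δ x v ≡ t → 1 ≤ t → t < L → Rainbow ⊎ c v ≡ X
    forced-X v δzv≡L δxv≡t 1≤t t<L =
      colour-cases v inj₂ (inj₁ ∘ Y-far-from-z v δzv≡L) (inj₁ ∘ Z-near-x v δxv≡t 1≤t t<L)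

    forced-Z : ∀ v {t} → δ x v ≡ L → δ z v ≡ t → 1 ≤ t → t < L → Rainbow ⊎ c v ≡ Z
    forced-Z v δxv≡L δzv≡t 1≤t t<L =
      colour-cases v (inj₁ ∘ X-near-z v δzv≡t 1≤t t<L) (inj₁ ∘ Y-far-from-x v δxv≡L) inj₂

    forced-Y : ∀ v {t t'} → δ x v ≡ t → 1 ≤ t → t < L → δ z v ≡ t' → 1 ≤ t' → t' < L → Rainbow ⊎ c v ≡ Y
    forced-Y v δxv≡t 1≤t t<L δzv≡t' 1≤t' t'<L =
      colour-cases v (inj₁ ∘ X-near-z v δzv≡t' 1≤t' t'<L) inj₂ (inj₁ ∘ Z-near-x v δxv≡t 1≤t t<L)

    layered-via-neighbour : ∀ x' w → c x' ≡ X → δ x' z ≡ L → δ x w ≡ 1 → δ x' w ≡ 1 → L ≡ suc (δ w z) → Layered x' z L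
    layered-via-neighbour x' w x'-X δx'z≡L δxw≡1 δx'w≡1 L≡1+D = record
      { x-X = x'-X ; z-Z = z-Z ; δxz = δx'z≡L ; 3≤L = 3≤L ; L-odd = L-odd ; layer-x = layer-x' ; layer-z = layer-z }
      where
      -- The geodesic from w to z supplies the layers around x', as it does around x.
      layer-x' : ∀ t → 1 ≤ t → t < L → Rainbow ⊎ ∃ λ y → δ x' y ≡ t × c y ≡ Y
      layer-x' (suc t) _ 1+t<L = map₂ (λ y-Y → y , δx'y , y-Y) (forced-Y y δxy (s≤s z≤n) 1+t<L δzy (m<n⇒0<n∸m t<D) D-t<L)
        where
        D = δ w z
        t<D : t < D
        t<D = ≤-pred (subst (suc t <_) L≡1+D 1+t<L)
        y = geodesic w z at t
        δxy : δ x y ≡ suc t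
        δxy = δ-through-neighbour x w z δxw≡1 (trans δxz L≡1+D) (<⇒≤ t<D)
        δx'y : δ x' y ≡ suc t
        δx'y = δ-through-neighbour x' w z δx'w≡1 (trans δx'z≡L L≡1+D) (<⇒≤ t<D)
        δzy : δ z y ≡ D ∸ t
        δzy = trans (δ-sym z y) (δ-geodesic-end w z (<⇒≤ t<D))
        D-t<L : D ∸ t < L
        D-t<L = subst (D ∸ t <_) (sym L≡1+D) (s≤s (m∸n≤m D t))

  1≤h : 1 ≤ h
  1≤h = s≤s z≤n

  2≤h : 2 ≤ h
  2≤h = s≤s (s≤s z≤n)

  h'≤h : h' ≤ h
  h'≤h = m≤n⇒m≤1+n (n≤1+n h')

  1≤2 : 1 ≤ 2
  1≤2 = s≤s z≤n

  n₁≡h+h-1 : n₁ ≡ h + suc h'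
  n₁≡h+h-1 = suc-injective (trans n≡h+h (+-suc h (suc h')))

  h+1<n : suc h < n
  h+1<n = s≤s (subst (h <_) (sym n₁≡h+h-1) (m<m+n h z<s))

  1≤Δ+h' : ∀ Δ → 3 ≤ Δ + h → 1 ≤ Δ + h'
  1≤Δ+h' Δ 3≤Δ+h = ≤-pred (≤-pred (subst (3 ≤_) (trans (+-suc Δ (suc h')) (cong suc (+-suc Δ h'))) 3≤Δ+h))

  Δ+h'<Δ+h : ∀ Δ → Δ + h' < Δ + h
  Δ+h'<Δ+h Δ = +-monoʳ-< Δ (n≤1+n (suc h'))

  -- x = (i,0) and z = (i,e) share a row. In an adjacent row r, u = (r,1) is forced to colour X
  -- and v = (r,e-1) to colour Z, and p = (i,e-2) is forced to colour Y; then p, u, v is rainbow.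
  row-case : ∀ F {i r e} .(i<m : i < m) .(r<m : r < m) → ∣ i - r ∣ ≡ 1 → (e≤h : e ≤ h) →
             Layered (F ⊙ coord i i<m 0 z<s) (F ⊙ coord i i<m e (≤h⇒<n e≤h)) e → Rainbow
  row-case F {e = zero}           _ _ _ _ C with Layered.3≤L C
  ... | ()
  row-case F {e = suc zero}       _ _ _ _ C with Layered.3≤L C
  ... | s≤s ()
  row-case F {e = suc (suc zero)} _ _ _ _ C with Layered.3≤L C
  ... | s≤s (s≤s ())
  row-case F {i} {r} {suc (suc (suc e₃))} i<m r<m ∣i-r∣≡1 e≤h C =
    forced-X (F ⊙ u) δzu δxu 1≤2 2<e ⟫ λ u-X →
    forced-Z (F ⊙ v) δxv δzv 1≤2 2<e ⟫ λ v-Z →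
    forced-Y (F ⊙ p) δxp (s≤s z≤n) (n≤1+n e₂) δzp 1≤2 2<e ⟫ λ p-Y →
    rainbow (F ⊙ p) (F ⊙ u) (F ⊙ v) (coloured p-Y u-X (≢-sym X≢Y)) (coloured u-X v-Z X≢Z) (coloured p-Y v-Z Y≢Z)
            (trans δuv (sym δpu))
    where
    open Forcing C
    e₁ = suc e₃
    e₂ = suc e₁
    e  = suc e₂
    2<e = Layered.3≤L C
    e₂≤h = ≤-trans (n≤1+n e₂) e≤h
    e₁≤h = ≤-trans (n≤1+n e₁) e₂≤h
    e₃≤h = ≤-trans (n≤1+n e₃) e₁≤h
    x = coord i i<m 0 z<s
    z = coord i i<m e (≤h⇒<n e≤h)
    u = coord r r<m 1 (≤h⇒<n 1≤h)
    v = coord r r<m e₂ (≤h⇒<n e₂≤h)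
    p = coord i i<m e₁ (≤h⇒<n e₁≤h)
    δxu : δ (F ⊙ x) (F ⊙ u) ≡ 2
    δxu = δ-frame F x u ∣i-r∣≡1 (cyc-shift-value 0 1 1≤h (unwrapped refl))
    δzu : δ (F ⊙ z) (F ⊙ u) ≡ e
    δzu = δ-frame F z u ∣i-r∣≡1 (cyc-shift-value′ e 1 e₂≤h (unwrapped refl))
    δxv : δ (F ⊙ x) (F ⊙ v) ≡ e
    δxv = δ-frame F x v ∣i-r∣≡1 (cyc-shift-value 0 e₂ e₂≤h (unwrapped refl))
    δzv : δ (F ⊙ z) (F ⊙ v) ≡ 2
    δzv = δ-frame F z v ∣i-r∣≡1 (cyc-shift-value′ e e₂ 1≤h (unwrapped (+-comm e₂ 1)))
    δxp : δ (F ⊙ x) (F ⊙ p) ≡ e₁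
    δxp = δ-frame F x p (∣n-n∣≡0 i) (cyc-shift-value 0 e₁ e₁≤h (unwrapped refl))
    δzp : δ (F ⊙ z) (F ⊙ p) ≡ 2
    δzp = δ-frame F z p (∣n-n∣≡0 i) (cyc-shift-value′ e e₁ 2≤h (unwrapped (+-comm e₁ 2)))
    δpu : δ (F ⊙ p) (F ⊙ u) ≡ e₁
    δpu = δ-frame F p u ∣i-r∣≡1 (cyc-shift-value′ e₁ 1 e₃≤h (unwrapped refl))
    δuv : δ (F ⊙ u) (F ⊙ v) ≡ e₁
    δuv = δ-frame F u v (∣n-n∣≡0 r) (cyc-shift-value 1 e₂ e₁≤h (unwrapped refl))

  -- x = (i'+1,0) and z = (i'+1+Δ,h) are antipodal in the cycle coordinate. In the row before x,
  -- u = (i',-1) is forced to colour X, and b = (i'+1+Δ,h-2) to colour Y; then z, u, b is rainbow.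
  top-before : ∀ F {i' Δ} .(i'<m : i' < m) .(i<m : suc i' < m) .(z<m : suc i' + Δ < m) →
               Layered (F ⊙ coord (suc i') i<m 0 z<s) (F ⊙ coord (suc i' + Δ) z<m h h<n) (Δ + h) → Rainbow
  top-before F {i'} {Δ} i'<m i<m z<m C =
    forced-X (F ⊙ u) δzu δxu 1≤2 2<L ⟫ λ u-X →
    forced-Y (F ⊙ b) δxb (1≤Δ+h' Δ 2<L) (Δ+h'<Δ+h Δ) δzb 1≤2 2<L ⟫ λ b-Y →
    rainbow (F ⊙ z) (F ⊙ u) (F ⊙ b) (coloured (Layered.z-Z C) u-X (≢-sym X≢Z)) (coloured u-X b-Y X≢Y)
            (coloured (Layered.z-Z C) b-Y (≢-sym Y≢Z)) (trans δub (sym δzu))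
    where
    open Forcing C
    2<L = Layered.3≤L C
    x = coord (suc i') i<m 0 z<s
    z = coord (suc i' + Δ) z<m h h<n
    u = coord i' i'<m n₁ ≤-refl
    b = coord (suc i' + Δ) z<m h' (≤h⇒<n h'≤h)
    δxu : δ (F ⊙ x) (F ⊙ u) ≡ 2
    δxu = δ-frame F x u (∣1+m-m∣≡1 i') (cyc-shift-value′ 0 n₁ 1≤h (wrapped (+-comm n₁ 1)))
    δzu : δ (F ⊙ z) (F ⊙ u) ≡ Δ + h
    δzu = trans (δ-frame F z u (trans (cong ∣_- i' ∣ (sym (+-suc i' Δ))) (∣m+n-m∣≡n i' (suc Δ)))
                             (cyc-shift-value h n₁ (n≤1+n _) (unwrapped (sym n₁≡h+h-1))))
                (sym (+-suc Δ (suc h')))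
    δxb : δ (F ⊙ x) (F ⊙ b) ≡ Δ + h'
    δxb = δ-frame F x b (∣m-m+n∣≡n (suc i') Δ) (cyc-shift-value 0 h' h'≤h (unwrapped refl))
    δzb : δ (F ⊙ z) (F ⊙ b) ≡ 2
    δzb = δ-frame F z b (∣n-n∣≡0 (suc i' + Δ)) (cyc-shift-value′ h h' 2≤h (unwrapped (+-comm h' 2)))
    n₁+h-1≡h'+n : n₁ + suc h' ≡ h' + n
    n₁+h-1≡h'+n = trans (cong (_+ suc h') n₁≡h+h-1) (trans (arith h') (cong (h' +_) (sym n≡h+h)))
      where
      arith : ∀ a → (suc (suc a) + suc a) + suc a ≡ a + (suc (suc a) + suc (suc a))
      arith = solve-∀
    δub : δ (F ⊙ u) (F ⊙ b) ≡ Δ + h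
    δub = trans (δ-frame F u b (trans (cong (∣ i' -_∣) (sym (+-suc i' Δ))) (∣m-m+n∣≡n i' (suc Δ)))
                             (cyc-shift-value n₁ h' (n≤1+n _) (wrapped n₁+h-1≡h'+n)))
                (sym (+-suc Δ (suc h')))

  -- The mirror image: in the row after z, v = (i+Δ+1,h+1) is forced to colour Z, and
  -- b = (i,2) to colour Y; then x, v, b is rainbow.
  top-after : ∀ F {i Δ} .(i<m : i < m) .(z<m : i + Δ < m) .(v<m : suc (i + Δ) < m) →
              Layered (F ⊙ coord i i<m 0 z<s) (F ⊙ coord (i + Δ) z<m h h<n) (Δ + h) → Rainbow
  top-after F {i} {Δ} i<m z<m v<m C =
    forced-Z (F ⊙ v) δxv δzv 1≤2 2<L ⟫ λ v-Z →
    forced-Y (F ⊙ b) δxb 1≤2 2<L δzb (1≤Δ+h' Δ 2<L) (Δ+h'<Δ+h Δ) ⟫ λ b-Y →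
    rainbow (F ⊙ x) (F ⊙ v) (F ⊙ b) (coloured (Layered.x-X C) v-Z X≢Z) (coloured v-Z b-Y (≢-sym Y≢Z))
            (coloured (Layered.x-X C) b-Y X≢Y) (trans δvb (sym δxv))
    where
    open Forcing C
    2<L = Layered.3≤L C
    x = coord i i<m 0 z<s
    z = coord (i + Δ) z<m h h<n
    v = coord (suc (i + Δ)) v<m (suc h) h+1<n
    b = coord i i<m 2 (≤h⇒<n 2≤h)
    δzv : δ (F ⊙ z) (F ⊙ v) ≡ 2
    δzv = δ-frame F z v (∣m-1+m∣≡1 (i + Δ)) (cyc-shift-value h (suc h) 1≤h (unwrapped (+-comm h 1)))
    δxv : δ (F ⊙ x) (F ⊙ v) ≡ Δ + h
    δxv = trans (δ-frame F x v (trans (cong (∣ i -_∣) (sym (+-suc i Δ))) (∣m-m+n∣≡n i (suc Δ)))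
                             (cyc-shift-value′ 0 (suc h) (n≤1+n _) (wrapped (cong suc (sym n₁≡h+h-1)))))
                (sym (+-suc Δ (suc h')))
    δxb : δ (F ⊙ x) (F ⊙ b) ≡ 2
    δxb = δ-frame F x b (∣n-n∣≡0 i) (cyc-shift-value 0 2 2≤h (unwrapped refl))
    δzb : δ (F ⊙ z) (F ⊙ b) ≡ Δ + h'
    δzb = δ-frame F z b (∣m+n-m∣≡n i Δ) (cyc-shift-value′ h 2 h'≤h (unwrapped refl))
    δvb : δ (F ⊙ v) (F ⊙ b) ≡ Δ + h
    δvb = trans (δ-frame F v b (trans (cong ∣_- i ∣ (sym (+-suc i Δ))) (∣m+n-m∣≡n i (suc Δ)))
                             (cyc-shift-value′ (suc h) 2 (n≤1+n _) (unwrapped refl)))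
                (sym (+-suc Δ (suc h')))

  -- The vertex x' = (i+1,-1) is forced to colour X and
  -- shares with x the neighbour w = (i+1,0); in the frame rotated by one column x' and z
  -- become (i+1,0) and (i+1+Δ',e+1).
  shift-step : ∀ F {i Δ' e L} .(i<m : i < m) (z<m : i + suc Δ' < m) (e<h : e < h) → L ≡ suc Δ' + e →
               Layered (F ⊙ coord i i<m 0 z<s) (F ⊙ coord (i + suc Δ') z<m e (≤h⇒<n (<⇒≤ e<h))) L →
               Rainbow ⊎ Layered (rotated F ⊙ coord (suc i) (≤-<-trans (m≤m+n (suc i) Δ') (subst (_< m) (+-suc i Δ') z<m)) 0 z<s)
                                 (rotated F ⊙ coord (suc i + Δ') (subst (_< m) (+-suc i Δ') z<m) (suc e) (≤h⇒<n e<h)) L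
  shift-step F {i} {Δ'} {e} {L} i<m z<m e<h L≡ C = map₂ shifted (forced-X (F ⊙ x') δzx' δxx' 1≤2 (Layered.3≤L C))
    where
    open Forcing C
    z<m' = subst (_< m) (+-suc i Δ') z<m
    i+1<m = ≤-<-trans (m≤m+n (suc i) Δ') z<m'
    x  = coord i i<m 0 z<s
    z  = coord (i + suc Δ') z<m e (≤h⇒<n (<⇒≤ e<h))
    x' = coord (suc i) i+1<m n₁ ≤-refl
    w  = coord (suc i) i+1<m 0 z<s
    δxx' : δ (F ⊙ x) (F ⊙ x') ≡ 2
    δxx' = δ-frame F x x' (∣m-1+m∣≡1 i) (cyc-shift-value′ 0 n₁ 1≤h (wrapped (+-comm n₁ 1)))
    δzx' : δ (F ⊙ z) (F ⊙ x') ≡ L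
    δzx' = trans (δ-frame F z x' (trans (cong ∣_- suc i ∣ (+-suc i Δ')) (∣m+n-m∣≡n (suc i) Δ'))
                                (cyc-shift-value′ e n₁ e<h (wrapped (trans (+-suc n₁ e) (+-comm (suc n₁) e)))))
                 (trans (+-suc Δ' e) (sym L≡))
    δxw : δ (F ⊙ x) (F ⊙ w) ≡ 1
    δxw = δ-frame F x w (∣m-1+m∣≡1 i) refl
    δx'w : δ (F ⊙ x') (F ⊙ w) ≡ 1
    δx'w = δ-frame F x' w (∣n-n∣≡0 (suc i)) (cyc-shift-value n₁ 0 1≤h (wrapped (+-comm n₁ 1)))
    δwz : δ (F ⊙ w) (F ⊙ z) ≡ Δ' + e
    δwz = δ-frame F w z (trans (cong (∣ suc i -_∣) (+-suc i Δ')) (∣m-m+n∣≡n (suc i) Δ')) (cyc-shift-value 0 e (<⇒≤ e<h) (unwrapped refl))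
    x'≡ : F ⊙ x' ≡ rotated F ⊙ coord (suc i) i+1<m 0 z<s
    x'≡ = cong (pathMap F (fromℕ< i+1<m) ,_) (cong (cycleMap F) (sym rotate⁻¹-zero))
    z≡ : F ⊙ z ≡ rotated F ⊙ coord (suc i + Δ') z<m' (suc e) (≤h⇒<n e<h)
    z≡ = trans (⊙-cong F (+-suc i Δ') refl)
               (cong (pathMap F (fromℕ< z<m') ,_) (cong (cycleMap F) (sym (rotate⁻¹-suc (≤h⇒<n (<⇒≤ e<h)) (≤h⇒<n e<h)))))
    shifted : c (F ⊙ x') ≡ X → Layered _ _ L
    shifted x'-X = subst₂ (λ a b → Layered a b L) x'≡ z≡
      (layered-via-neighbour (F ⊙ x') (F ⊙ w) x'-X (trans (δ-sym (F ⊙ x') (F ⊙ z)) δzx') δxw δx'w (trans L≡ (cong suc (sym δwz))))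

  adjacent-row : ∀ i → i < m → ∃ λ r → r < m × ∣ i - r ∣ ≡ 1
  adjacent-row i i<m with suc i <? m
  ... | yes i+1<m = suc i , i+1<m , ∣m-1+m∣≡1 i
  adjacent-row zero     _   | no i+1≮m = ⊥-elim (i+1≮m 1<m)
  adjacent-row (suc i') i<m | no _     = i' , <-trans (n<1+n i') i<m , ∣1+m-m∣≡1 i'

  -- x and z are antipodal on the cycle; if they also span the whole path, L is the (even) diameter.
  top : ∀ Δ F i (z<m : i + Δ < m) →
        Layered (F ⊙ coord i (≤-<-trans (m≤m+n i Δ) z<m) 0 z<s) (F ⊙ coord (i + Δ) z<m h h<n) (Δ + h) → Rainbow
  top Δ F (suc i') z<m C = top-before F (<-trans (n<1+n i') (≤-<-trans (m≤m+n (suc i') Δ) z<m)) _ z<m C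
  top Δ F zero     z<m C with suc Δ <? m
  ... | yes Δ+1<m = top-after F _ z<m Δ+1<m C
  ... | no  Δ+1≮m = ⊥-elim (even⇒¬odd (subst (λ d → Even (d + h)) pred-m≡Δ diameter-even) (Layered.L-odd C))
    where
    pred-m≡Δ : pred m ≡ Δ
    pred-m≡Δ = cong pred (≤-antisym (≮⇒≥ Δ+1≮m) z<m)

  layered-core : ∀ Δ F i e L (z<m : i + Δ < m) (e≤h : e ≤ h) → L ≡ Δ + e →
                 Layered (F ⊙ coord i (≤-<-trans (m≤m+n i Δ) z<m) 0 z<s) (F ⊙ coord (i + Δ) z<m e (≤h⇒<n e≤h)) L → Rainbow
  layered-core Δ F i e L z<m e≤h L≡ C with e ≟ h
  ... | yes refl = top Δ F i z<m (subst (Layered _ _) L≡ C)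
  layered-core zero F i e L z<m e≤h L≡ C | no _ with adjacent-row i i<m
    where i<m = ≤-<-trans (m≤m+n i 0) z<m
  ... | r , r<m , ∣i-r∣≡1 =
    row-case F i<m r<m ∣i-r∣≡1 e≤h (subst₂ (Layered (F ⊙ coord i i<m 0 z<s)) (⊙-cong F (+-identityʳ i) refl) L≡ C)
    where i<m = ≤-<-trans (m≤m+n i 0) z<m
  layered-core (suc Δ') F i e L z<m e≤h L≡ C | no e≢h with shift-step F _ z<m (≤∧≢⇒< e≤h e≢h) L≡ C
  ... | inj₁ r  = r
  ... | inj₂ C′ = layered-core Δ' (rotated F) (suc i) (suc e) L (subst (_< m) (+-suc i Δ') z<m) (≤∧≢⇒< e≤h e≢h)
                               (trans L≡ (sym (+-suc Δ' e))) C′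

  layered⇒rainbow : ∀ {x z L} → Layered x z L → Rainbow
  layered⇒rainbow {x} {z} {L} C = layered-core Δ frame i e L i+Δ<m e≤h L≡Δ+e (subst₂ (λ a b → Layered a b L) (sym x≡) (sym z≡) C)
    where
    open Normalised (normalise x z)
    L≡Δ+e : L ≡ Δ + e
    L≡Δ+e = trans (sym (Layered.δxz C)) (trans (cong₂ δ (sym x≡) (sym z≡))
              (δ-frame frame (coord i (≤-<-trans (m≤m+n i Δ) i+Δ<m) 0 z<s) (coord (i + Δ) i+Δ<m e (≤h⇒<n e≤h))
                       (∣m-m+n∣≡n i Δ) (cyc-shift-value 0 e e≤h (unwrapped refl))))

-- Exact colourings

bichromatic-edge : ∀ {G : Graph} {r} (c : V G → Fin r) {u v ℓ} → Walk G u v ℓ → c u ≢ c v →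
                   ∃ λ p → ∃ λ q → Adj G p q × c p ≢ c q
bichromatic-edge c here cu≢cv = ⊥-elim (cu≢cv refl)
bichromatic-edge c {u} (step {w = w} e p) cu≢cv with c u ≟ᶠ c w
... | yes cu≡cw = bichromatic-edge c p (λ cw≡cv → cu≢cv (trans cu≡cw cw≡cv))
... | no  cu≢cw = u , w , e , cu≢cw

positive-half : ∀ q {s} → s ≤ suc (2 * q) → 2 ≤ s → 1 ≤ q
positive-half zero    s≤1 2≤s with ≤-trans 2≤s s≤1
... | s≤s ()
positive-half (suc q) _   _   = s≤s z≤n

module ExactColourings (m n₁ h' : ℕ) (n≡h+h : suc n₁ ≡ suc (suc h') + suc (suc h')) (1<m : 1 < m)
                       (diameter-even : Even (pred m + suc (suc h')))
                       (c : Fin m × Fin (suc n₁) → Fin 3) where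

  open EvenCylinder m n₁ (suc (suc h')) n≡h+h
  open Rainbows cylinderMetric (□-sym P-sym C-sym) c using (Rainbow; rainbow)

  module GeodesicWindow {u v ℓ} (p : Walk Cyl u v ℓ) (geo : δ u v ≡ ℓ) (W : Windows.Window (λ t → c (p at t)))
                        (end≤ℓ : Windows.Window.start W + Windows.Window.len W ≤ ℓ) where
    open Windows.Window W

    δ-pos : ∀ i j → i ≤ j → j ≤ start + len → δ (p at i) (p at j) ≡ j ∸ i
    δ-pos i j i≤j j≤end = δ-along-geodesic p geo i j i≤j (≤-trans j≤end end≤ℓ)

    x = p at start
    z = p at (start + len)

    even⇒rainbow : Even len → Rainbow
    even⇒rainbow (q , len≡2q) = rainbow x mid z (≢-sym (proj₁ mid-interior)) (proj₂ mid-interior) ends-differ (trans δmz (sym δxm))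
      where
      1≤q : 1 ≤ q
      1≤q = positive-half q (≤-trans (≤-reflexive len≡2q) (n≤1+n _)) 2≤len
      mid = p at (start + q)
      mid<end : start + q < start + len
      mid<end = +-monoʳ-< start (subst (q <_) (sym len≡2q) (m<m+n q (subst (0 <_) (sym (+-identityʳ q)) 1≤q)))
      mid-interior = interior (start + q) (m<m+n start 1≤q) mid<end
      δxm : δ x mid ≡ q
      δxm = trans (δ-pos start (start + q) (m≤m+n start q) (<⇒≤ mid<end)) (m+n∸m≡n start q)
      δmz : δ mid z ≡ q
      δmz = trans (δ-pos (start + q) (start + len) (<⇒≤ mid<end) ≤-refl)
                  (trans ([m+n]∸[m+o]≡n∸o start len q) (trans (cong (_∸ q) len≡2q) (trans (m+n∸m≡n q (q + 0)) (+-identityʳ q))))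

    -- The interior has a single colour Y, and its points supply the layers around both ends.
    odd⇒rainbow : Odd len → Rainbow
    odd⇒rainbow (q , len≡1+2q) = layered⇒rainbow layered
      where
      y₁ = p at suc start
      y₁-interior = interior (suc start) ≤-refl (≤-trans (≤-reflexive (+-comm 2 start)) (+-monoʳ-≤ start 2≤len))
      x≢y₁ : c x ≢ c y₁
      x≢y₁ = ≢-sym (proj₁ y₁-interior)
      open LayeredPairs m n₁ h' n≡h+h 1<m diameter-even c (c x) (c y₁) (c z) x≢y₁ (proj₂ y₁-interior) ends-differ
        using (Layered; layered⇒rainbow)
      interior-Y : ∀ t → start < t → t < start + len → c (p at t) ≡ c y₁
      interior-Y t start<t t<end = colours-exhausted _ _ _ (c (p at t)) (≢-sym x≢y₁) ends-differ (proj₂ y₁-interior)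
                                     (proj₁ (interior t start<t t<end)) (proj₂ (interior t start<t t<end))
      1≤q : 1 ≤ q
      1≤q = positive-half q (≤-reflexive len≡1+2q) 2≤len
      layer-x : ∀ t → 1 ≤ t → t < len → ∃ λ y → δ x y ≡ t × c y ≡ c y₁
      layer-x t 1≤t t<len =
        p at (start + t) , trans (δ-pos start (start + t) (m≤m+n start t) (+-monoʳ-≤ start (<⇒≤ t<len))) (m+n∸m≡n start t)
                         , interior-Y (start + t) (m<m+n start 1≤t) (+-monoʳ-< start t<len)
      layer-z : ∀ t → 1 ≤ t → t < len → ∃ λ y → δ z y ≡ t × c y ≡ c y₁
      layer-z t 1≤t t<len =
        y , trans (δ-sym z y) (trans (δ-pos (start + (len ∸ t)) (start + len) (+-monoʳ-≤ start (m∸n≤m len t)) ≤-refl)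
                                     (trans ([m+n]∸[m+o]≡n∸o start len (len ∸ t)) (m∸[m∸n]≡n (<⇒≤ t<len))))
          , interior-Y (start + (len ∸ t)) (m<m+n start (m<n⇒0<n∸m t<len)) (+-monoʳ-< start (∸-monoʳ-< 1≤t (<⇒≤ t<len)))
        where y = p at (start + (len ∸ t))
      layered : Layered x z len
      layered = record
        { x-X     = refl
        ; z-Z     = refl
        ; δxz     = trans (δ-pos start (start + len) (m≤m+n start len) ≤-refl) (m+n∸m≡n start len)
        ; 3≤L     = subst (3 ≤_) (sym len≡1+2q) (s≤s (+-mono-≤ 1≤q (≤-trans 1≤q (m≤m+n q 0))))
        ; L-odd   = q , len≡1+2q
        ; layer-x = λ t 1≤t t<len → inj₂ (layer-x t 1≤t t<len)
        ; layer-z = λ t 1≤t t<len → inj₂ (layer-z t 1≤t t<len)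
        }

    window⇒rainbow : Rainbow
    window⇒rainbow = [ even⇒rainbow , odd⇒rainbow ]′ (even-or-odd len)

  -- Along the walk from w through p to q all three colours occur, so it contains a window.
  farther-endpoint⇒rainbow : ∀ w p q → Adj Cyl p q → δ w q ≡ suc (δ w p) → c w ≢ c p → c p ≢ c q → c w ≢ c q → Rainbow
  farther-endpoint⇒rainbow w p q pq δwq≡ w≢p p≢q w≢q = GeodesicWindow.window⇒rainbow walk δwq≡ W end≤
    where
    walk = snocʷ (geodesic w p) pq
    open Windows (λ t → c (walk at t))
    all-colours : AllColours 0 (suc (δ w p))
    all-colours κ with κ ≟ᶠ c w | κ ≟ᶠ c p
    ... | yes κ≡w | _       = 0 , z≤n , z≤n , trans (cong c (at-zero walk)) (sym κ≡w)
    ... | no  _   | yes κ≡p = δ w p , z≤n , n≤1+n _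
                              , trans (cong c (trans (at-snoc (geodesic w p) pq _ ≤-refl) (at-end (geodesic w p)))) (sym κ≡p)
    ... | no  κ≢w | no  κ≢p = suc (δ w p) , z≤n , ≤-refl
                              , trans (cong c (at-end walk)) (sym (colours-exhausted (c q) (c w) (c p) κ (≢-sym w≢q) w≢p (≢-sym p≢q) κ≢w κ≢p))
    W,bounds = window (suc (δ w p)) 0 all-colours
    W = proj₁ W,bounds
    end≤ = proj₂ (proj₂ W,bounds)

  exact⇒rainbow : (∀ i → ∃ λ v → c v ≡ i) → Rainbow
  exact⇒rainbow surj with bichromatic-edge c (geodesic v₀ v₁) c₀≢c₁
    where
    v₀ = proj₁ (surj Fin.zero)
    v₁ = proj₁ (surj (Fin.suc Fin.zero))
    c₀≢c₁ : c v₀ ≢ c v₁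
    c₀≢c₁ e with trans (sym (proj₂ (surj Fin.zero))) (trans e (proj₂ (surj (Fin.suc Fin.zero))))
    ... | ()
  ... | p , q , pq , p≢q with third-colour (c p) (c q)
  ...   | κ , κ≢p , κ≢q with surj κ
  ...     | w , refl with <-cmp (δ w p) (δ w q)
  ...       | tri≈ _ δwp≡δwq _ = rainbow p w q (≢-sym κ≢p) κ≢q p≢q (trans (sym δwp≡δwq) (δ-sym w p))
  ...       | tri< δwp<δwq _ _ = farther-endpoint⇒rainbow w p q pq (≤-antisym (δ-neighbour-≤ w pq) δwp<δwq) κ≢p p≢q κ≢q
  ...       | tri> _ _ δwq<δwp = farther-endpoint⇒rainbow w q p qp (≤-antisym (δ-neighbour-≤ w qp) δwq<δwp) κ≢q (≢-sym p≢q) κ≢p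
    where qp = □-sym P-sym C-sym pq

rainbow⇒three-colours : ∀ {G r} → r < 3 → (c : V G → Fin r) → ¬ HasRainbow3AP G c
rainbow⇒three-colours {r = 0} _ c (v₁ , _) = ¬Fin0 (c v₁)
rainbow⇒three-colours {r = 1} _ c (v₁ , v₂ , _ , (c₁≢c₂ , _) , _) with c v₁ | c v₂
... | Fin.zero | Fin.zero = c₁≢c₂ refl
rainbow⇒three-colours {r = 2} _ c (v₁ , v₂ , v₃ , (c₁≢c₂ , c₂≢c₃ , c₁≢c₃) , _) = c₁≢c₃ (two-colours _ _ _ c₁≢c₂ c₂≢c₃)
rainbow⇒three-colours {r = suc (suc (suc _))} (s≤s (s≤s (s≤s ()))) _ _

two-colours⇒aw≥3 : ∀ {G} → ExactColoring G 2 → ∀ r → 1 ≤ r → r < 3 → ¬ AllRainbow G r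
two-colours⇒aw≥3 (c , surj) 1 _ 1<3 all = rainbow⇒three-colours 1<3 _ (all ((λ _ → Fin.zero) , λ { Fin.zero → proj₁ (surj Fin.zero) , refl }))
two-colours⇒aw≥3 (c , surj) 2 _ 2<3 all = rainbow⇒three-colours 2<3 c (all (c , surj))
two-colours⇒aw≥3 _ (suc (suc (suc _))) _ (s≤s (s≤s (s≤s ())))

cylinder-two-colouring : ∀ m n → 0 < m → 1 < n → ExactColoring (P m □ C n) 2
cylinder-two-colouring m (suc (suc n)) 0<m (s≤s (s≤s _)) = colour , surj
  where
  colour : V (P m □ C (suc (suc n))) → Fin 2
  colour (_ , Fin.zero)  = Fin.zero
  colour (_ , Fin.suc _) = Fin.suc Fin.zero
  surj : ∀ i → ∃ λ v → colour v ≡ i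
  surj Fin.zero           = (fromℕ< 0<m , Fin.zero) , refl
  surj (Fin.suc Fin.zero) = (fromℕ< 0<m , Fin.suc Fin.zero) , refl

lemma11 : (m k : ℕ) → 3 ≤ m → (∃ λ j → m ≡ 2 * j + 1) → 1 ≤ k →
    AW3 (P m □ C (4 * k)) 3
lemma11 m (suc k') 3≤m (j , m≡2j+1) _ =
  s≤s z≤n ,
  (λ { (c , surj) → ExactColourings.exact⇒rainbow m _ (2 * k') (n≡h+h k') 1<m diameter-even c surj }) ,
  two-colours⇒aw≥3 (cylinder-two-colouring m (4 * suc k') (<-trans z<s 1<m) (≤-trans (s≤s (s≤s z≤n)) (*-monoʳ-≤ 4 (s≤s (z≤n {k'})))))
  where
  n≡h+h : ∀ k' → 4 * suc k' ≡ suc (suc (2 * k')) + suc (suc (2 * k'))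
  n≡h+h = solve-∀
  1<m : 1 < m
  1<m = ≤-trans (s≤s (s≤s z≤n)) 3≤m
  -- (m - 1) + n/2 = 2j + 2k.
  diameter-even : Even (pred m + suc (suc (2 * k')))
  diameter-even = j + suc k' , trans (cong (λ d → pred d + suc (suc (2 * k'))) (trans m≡2j+1 (+-comm (2 * j) 1))) (arith j k')
    where
    arith : ∀ j k' → 2 * j + suc (suc (2 * k')) ≡ 2 * (j + suc k')
    arith = solve-∀
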